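{- Let $k,l$ be non-negative integers and let $G$ be a Helly graph containing a $(k,l)$-frame of the third type with corner vertices $a,b,c,d$. Then $G$ has an isometric subgraph isomorphic to $H_3^{k,l}$ via an isomorphism sending the corner points $a,b,c,d$ of $H_3^{k,l}$ to the vertices $a,b,c,d$ of $G$, respectively.
   Context: Graphs are finite, connected, unweighted, undirected and simple; $d_G$ is the shortest-path distance of $G$. A subgraph $H$ of $G$ is isometric if it is induced and $d_H=d_G$ on its vertices. A graph is Helly if every family of pairwise intersecting disks $D(v,r)=\{u:d(u,v)\le r\}$ has a common vertex. A $(k,l)$-frame of the third type in $G$ consists of vertices $a,b,c,d,a_b,a_d,b_a,b_c,c_b,c_d,d_c,d_a$ such that each of $\{a,a_b,a_d\}$, $\{b,b_a,b_c\}$, $\{c,c_b,c_d\}$, $\{d,d_c,d_a\}$ is a triangle of $G$, together with paths of $G$ from $a_b$ to $b_a$ of length $l$, from $b_c$ to $c_b$ of length $k$, from $c_d$ to $d_c$ of length $l$ and from $d_a$ to $a_d$ of length $k$, such that in the subgraph $G'$ formed by these triangles and paths $d_{G'}(p,q)=d_G(p,q)$ for all $p,q\in\{a,b,c,d\}$, where $d_G(a,c)=d_G(b,d)=k+l+3$, $d_G(a,b)=d_G(c,d)=l+2$, $d_G(b,c)=d_G(d,a)=k+2$; its corner vertices are $a,b,c,d$. King-grid: the graph on $\mathbb{Z}^2$ in which distinct $(x,y),(x',y')$ are adjacent iff $\max(|x-x'|,|y-y'|)=1$. For $u=(x,y)$ let $s(u)=x+y$, $t(u)=x-y$. $H_3^{k,l}$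 is the subgraph of the King-grid induced by $\{u: 0\le s(u)\le 2k+2,\ -1\le t(u)\le 2l+1\}\cup\{(l,-l-1),(-1,1),(k+1,k+2),(k+l+2,k-l)\}$, with corner points $a=(l,-l-1)$, $b=(-1,1)$, $c=(k+1,k+2)$, $d=(k+l+2,k-l)$. -}

module Defs where

open import Data.Nat as ℕ using (ℕ; zero; suc)
open import Data.Integer as ℤ using (ℤ; +_; -[1+_]; ∣_∣)
open import Data.Fin using (Fin; zero; suc; inject₁; fromℕ)
open import Data.Product using (Σ; ∃; _×_; _,_)
open import Data.Sum using (_⊎_)
open import Relation.Nullary using (¬_; Dec)
open import Relation.Binary.PropositionalEquality using (_≡_; _≢_)

data Walk {V : Set} (E : V → V → Set) : V → V → ℕ → Set where
  []  : ∀ {u} → Walk E u u 0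
  _∷_ : ∀ {u w v m} → E u w → Walk E w v m → Walk E u v (suc m)

Dist : {V : Set} (E : V → V → Set) → V → V → ℕ → Set
Dist E u v m = Walk E u v m × (∀ {m′} → Walk E u v m′ → m ℕ.≤ m′)

record Graph : Set₁ where
  field
    n         : ℕ
    _~_       : Fin n → Fin n → Set
    ~-dec     : ∀ u v → Dec (u ~ v)
    ~-sym     : ∀ {u v} → u ~ v → v ~ u
    ~-irrefl  : ∀ {u} → ¬ (u ~ u)
    connected : ∀ u v → ∃ λ m → Walk _~_ u v m

module _ (G : Graph) where
  open Graph G

  V : Set
  V = Fin n

  InDisk : V → V → ℕ → Set
  InDisk u v r = ∃ λ m → Dist _~_ v u m × m ℕ.≤ r

  Helly : Set₁
  Helly = (I : Set) (c : I → V) (r : I → ℕ) →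
          (∀ i j → ∃ λ u → InDisk u (c i) (r i) × InDisk u (c j) (r j)) →
          ∃ λ u → ∀ i → InDisk u (c i) (r i)

  record Path (x y : V) (len : ℕ) : Set where
    field
      vtx   : Fin (suc len) → V
      start : vtx zero ≡ x
      end   : vtx (fromℕ len) ≡ y
      step  : ∀ (i : Fin len) → vtx (inject₁ i) ~ vtx (suc i)
      inj   : ∀ i j → vtx i ≡ vtx j → i ≡ j

  Triangle : V → V → V → Set
  Triangle x y z = (x ~ y) × (y ~ z) × (x ~ z)

  PathEdge : ∀ {x y len} → Path x y len → V → V → Set
  PathEdge {len = len} P u v =
    ∃ λ (i : Fin len) →
      (u ≡ Path.vtx P (inject₁ i) × v ≡ Path.vtx P (suc i)) ⊎
      (v ≡ Path.vtx P (inject₁ i) × u ≡ Path.vtx P (suc i))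

  TriEdge : V → V → V → V → V → Set
  TriEdge x y z u v =
    (u ≡ x × v ≡ y) ⊎ (u ≡ y × v ≡ x) ⊎
    (u ≡ y × v ≡ z) ⊎ (u ≡ z × v ≡ y) ⊎
    (u ≡ x × v ≡ z) ⊎ (u ≡ z × v ≡ x)

  record Frame3 (k l : ℕ) (a b c d : V) : Set where
    field
      a-b a-d b-a b-c c-b c-d d-c d-a : V
      tri-a : Triangle a a-b a-d
      tri-b : Triangle b b-a b-c
      tri-c : Triangle c c-b c-d
      tri-d : Triangle d d-c d-a
      P-ab  : Path a-b b-a l
      P-bc  : Path b-c c-b k
      P-cd  : Path c-d d-c l
      P-da  : Path d-a a-d k

    -- edge relation of the subgraph G' formed by the triangles and paths
    -- (vertices of G not in G' are isolated, which does not affect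
    -- distances between vertices of G')
    E′ : V → V → Set
    E′ u v = TriEdge a a-b a-d u v ⊎ TriEdge b b-a b-c u v ⊎
             TriEdge c c-b c-d u v ⊎ TriEdge d d-c d-a u v ⊎
             PathEdge P-ab u v ⊎ PathEdge P-bc u v ⊎
             PathEdge P-cd u v ⊎ PathEdge P-da u v

    field
      dG-ac  : Dist _~_ a c (k ℕ.+ l ℕ.+ 3)
      dG-bd  : Dist _~_ b d (k ℕ.+ l ℕ.+ 3)
      dG-ab  : Dist _~_ a b (l ℕ.+ 2)
      dG-cd  : Dist _~_ c d (l ℕ.+ 2)
      dG-bc  : Dist _~_ b c (k ℕ.+ 2)
      dG-da  : Dist _~_ d a (k ℕ.+ 2)
      dG′-ac : Dist E′ a c (k ℕ.+ l ℕ.+ 3)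
      dG′-bd : Dist E′ b d (k ℕ.+ l ℕ.+ 3)
      dG′-ab : Dist E′ a b (l ℕ.+ 2)
      dG′-cd : Dist E′ c d (l ℕ.+ 2)
      dG′-bc : Dist E′ b c (k ℕ.+ 2)
      dG′-da : Dist E′ d a (k ℕ.+ 2)

Point : Set
Point = ℤ × ℤ

s t : Point → ℤ
s (x , y) = x ℤ.+ y
t (x , y) = x ℤ.- y

King : Point → Point → Set
King p@(x , y) q@(x′ , y′) = p ≢ q × ∣ x ℤ.- x′ ∣ ℕ.≤ 1 × ∣ y ℤ.- y′ ∣ ℕ.≤ 1

module _ (k l : ℕ) where
  aH bH cH dH : Point
  aH = (+ l , ℤ.- (+ (l ℕ.+ 1)))
  bH = (-[1+ 0 ] , + 1)
  cH = (+ (k ℕ.+ 1) , + (k ℕ.+ 2))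
  dH = (+ (k ℕ.+ l ℕ.+ 2) , + k ℤ.- + l)

  InH : Point → Set
  InH u = ((+ 0 ℤ.≤ s u × s u ℤ.≤ + (2 ℕ.* k ℕ.+ 2)) ×
           (-[1+ 0 ] ℤ.≤ t u × t u ℤ.≤ + (2 ℕ.* l ℕ.+ 1)))
          ⊎ u ≡ aH ⊎ u ≡ bH ⊎ u ≡ cH ⊎ u ≡ dH

  EH : Point → Point → Set
  EH p q = InH p × InH q × King p q

-- G has an isometric subgraph isomorphic to H₃^{k,l} via an isomorphism
-- sending aH,bH,cH,dH to a,b,c,d: unfolded as a map f from the points of
-- H₃^{k,l} to V(G) that is injective, preserves and reflects adjacency
-- (so its image induces a subgraph isomorphic to H₃^{k,l}), and satisfies
-- d_G(f p, f q) = d_H(p, q) (so that induced subgraph is isometric).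
record IsometricH3 (G : Graph) (k l : ℕ) (a b c d : V G) : Set where
  open Graph G
  field
    f       : Point → V G
    f-inj   : ∀ p q → InH k l p → InH k l q → f p ≡ f q → p ≡ q
    f-adj   : ∀ p q → InH k l p → InH k l q → King p q → f p ~ f q
    f-adj⁻  : ∀ p q → InH k l p → InH k l q → f p ~ f q → King p q
    f-dist  : ∀ p q m → InH k l p → InH k l q →
              Dist (EH k l) p q m → Dist _~_ (f p) (f q) m
    f-dist⁻ : ∀ p q m → InH k l p → InH k l q →
              Dist _~_ (f p) (f q) m → Dist (EH k l) p q m
    f-a     : f (aH k l) ≡ a
    f-b     : f (bH k l) ≡ b
    f-c     : f (cH k l) ≡ c
    f-d     : f (dH k l) ≡ d

-- Since G is Helly, a partial map into G that does not increase distances extends to any new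
-- point: the disks around the images, with radii the distances to the new point, pairwise
-- intersect. Starting from the corners a, b, c, d, whose distances in G are the Chebyshev
-- distances between the corners of H₃^{k,l}, this gives f : H₃^{k,l} → G with
-- d_G(f p, f q) ≤ ‖p − q‖∞. For the converse, a, c and b, d are at distance k + l + 3: each
-- point of H₃^{k,l} sits at a "height" between a and c and between b and d, and a walk from
-- f p to f q shorter than a difference of heights would yield a walk from a to c or from b to d
-- shorter than k + l + 3. Finally H₃^{k,l} is geodesic for ‖·‖∞ (from every point some
-- neighbour is one step closer to any other point), so f is an isometric embedding.

module Submission where

-- Walk's constructors are opened only locally: in scope here they would make the variable
-- lists passed to the ring solver ambiguous.
open import Defs hiding ([]; _∷_)
open import Data.Nat
open import Data.Nat.Properties
open import Data.Nat.Tactic.RingSolver using (solve)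
open import Data.Integer as ℤ using (ℤ; +_; -[1+_]; ∣_∣)
import Data.Integer.Properties as ℤ
import Data.Integer.Tactic.RingSolver as ℤ-Solver
import Data.Fin.Properties as Fin
open import Data.List using (List; []; _∷_; upTo; cartesianProduct)
open import Data.List.Membership.Propositional using (_∈_)
open import Data.List.Membership.Propositional.Properties using (∈-cartesianProduct⁺; ∈-upTo⁺)
open import Data.List.Relation.Unary.All using (All)
import Data.List.Relation.Unary.All as All
open import Data.List.Relation.Unary.Any using (here; there)
open import Data.Product using (Σ; ∃; _×_; _,_; proj₁; proj₂)
open import Data.Product.Properties using (,-injectiveˡ; ,-injectiveʳ; ≡-dec)
open import Data.Sum using (_⊎_; inj₁; inj₂)
open import Data.Empty using (⊥-elim)
open import Function using (_∘_; id)
open import Function.Bundles using (_⇔_; mk⇔; Equivalence)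
open import Relation.Nullary using (¬_; Dec; yes; no)
open import Relation.Binary.Definitions using (DecidableEquality)
open import Relation.Binary.PropositionalEquality

module _ {V : Set} {E : V → V → Set} where
  open Walk using ([]; _∷_)

  infixr 5 _++ʷ_

  _++ʷ_ : ∀ {u v w m n} → Walk E u v m → Walk E v w n → Walk E u w (m + n)
  [] ++ʷ q = q
  (e ∷ p) ++ʷ q = e ∷ (p ++ʷ q)

  walk-0⇒≡ : ∀ {u v} → Walk E u v 0 → u ≡ v
  walk-0⇒≡ [] = refl

  walk-1⇒edge : ∀ {u v} → Walk E u v 1 → E u v
  walk-1⇒edge (e ∷ []) = e

  splitAtʷ : ∀ {u v m} r s → Walk E u v m → m ≤ r + s →
             ∃ λ w → (∃ λ m₁ → Walk E u w m₁ × m₁ ≤ r) × (∃ λ m₂ → Walk E w v m₂ × m₂ ≤ s)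
  splitAtʷ zero s p m≤s = _ , (0 , [] , z≤n) , (_ , p , m≤s)
  splitAtʷ (suc r) s [] _ = _ , (0 , [] , z≤n) , (0 , [] , z≤n)
  splitAtʷ (suc r) s (e ∷ p) (s≤s m≤r+s) with splitAtʷ r s p m≤r+s
  ... | w , (m₁ , p₁ , m₁≤r) , rest = w , (suc m₁ , e ∷ p₁ , s≤s m₁≤r) , rest

  dist-from-bounds : ∀ {u v r} → (∃ λ m → Walk E u v m × m ≤ r) → (∀ {m} → Walk E u v m → r ≤ m) → Dist E u v r
  dist-from-bounds (m , w , m≤r) lower = subst (Walk E _ _) (≤-antisym m≤r (lower w)) w , lower

  Dist-unique : ∀ {u v m n} → Dist E u v m → Dist E u v n → m ≡ n
  Dist-unique (w , shortest) (w′ , shortest′) = ≤-antisym (shortest w′) (shortest′ w)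

  module _ (E-sym : ∀ {u v} → E u v → E v u) where

    reverseʷ : ∀ {u v m} → Walk E u v m → Walk E v u m
    reverseʷ [] = []
    reverseʷ {m = suc m} (e ∷ p) = subst (Walk E _ _) (+-comm m 1) (reverseʷ p ++ʷ (E-sym e ∷ []))

module _ (G : Graph) where
  open Graph G
  open Walk using ([]; _∷_)

  walk? : ∀ m (u v : V G) → Dec (Walk _~_ u v m)
  walk? zero u v with u Fin.≟ v
  ... | yes refl = yes []
  ... | no u≢v = no (u≢v ∘ walk-0⇒≡)
  walk? (suc m) u v with Fin.any? (λ w → step? w)
    where
    step? : ∀ w → Dec ((u ~ w) × Walk _~_ w v m)
    step? w with ~-dec u w | walk? m w v
    ... | yes e | yes p = yes (e , p)
    ... | no ¬e | _ = no (¬e ∘ proj₁)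
    ... | yes _ | no ¬p = no (¬p ∘ proj₂)
  ... | yes (w , e , p) = yes (e ∷ p)
  ... | no ¬step = no λ { (e ∷ p) → ¬step (_ , e , p) }

  private
    first-walk : ∀ {u v} gap j → (∀ i → i < j → ¬ Walk _~_ u v i) → Walk _~_ u v (gap + j) →
                 ∃ λ m → Dist _~_ u v m × m ≤ gap + j
    first-walk {u} {v} gap j none p with walk? j u v
    ... | yes q = j , (q , minimal) , m≤n+m j gap
      where
      minimal : ∀ {m′} → Walk _~_ u v m′ → j ≤ m′
      minimal {m′} w with m′ <? j
      ... | yes m′<j = ⊥-elim (none m′ m′<j w)
      ... | no m′≮j = ≮⇒≥ m′≮j
    first-walk zero j none p | no ¬q = ⊥-elim (¬q p)
    first-walk {u} {v} (suc gap) j none p | no ¬q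
      with first-walk gap (suc j) none′ (subst (Walk _~_ u v) (sym (+-suc gap j)) p)
      where
      none′ : ∀ i → i < suc j → ¬ Walk _~_ u v i
      none′ i (s≤s i≤j) with m≤n⇒m<n∨m≡n i≤j
      ... | inj₁ i<j = none i i<j
      ... | inj₂ refl = ¬q
    ... | m , d , m≤ = m , d , ≤-trans m≤ (≤-reflexive (+-suc gap j))

  shortest-walk : ∀ {u v m} → Walk _~_ u v m → ∃ λ m′ → Dist _~_ u v m′ × m′ ≤ m
  shortest-walk {m = m} p with first-walk m 0 (λ _ ()) (subst (Walk _~_ _ _) (sym (+-identityʳ m)) p)
  ... | m′ , d , m′≤ = m′ , d , ≤-trans m′≤ (≤-reflexive (+-identityʳ m))

-- The Chebyshev distance on ℤ²

chebyshev : Point → Point → ℕ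
chebyshev (x , y) (x′ , y′) = ∣ x ℤ.- x′ ∣ ⊔ ∣ y ℤ.- y′ ∣

chebyshev-sym : ∀ p q → chebyshev p q ≡ chebyshev q p
chebyshev-sym (x , y) (x′ , y′) = cong₂ _⊔_ (ℤ.∣i-j∣≡∣j-i∣ x x′) (ℤ.∣i-j∣≡∣j-i∣ y y′)

chebyshev-refl : ∀ p → chebyshev p p ≡ 0
chebyshev-refl (x , y) = cong₂ _⊔_ (cong ∣_∣ (ℤ.+-inverseʳ x)) (cong ∣_∣ (ℤ.+-inverseʳ y))

∣i-k∣≤∣i-j∣+∣j-k∣ : ∀ i j k → ∣ i ℤ.- k ∣ ≤ ∣ i ℤ.- j ∣ + ∣ j ℤ.- k ∣
∣i-k∣≤∣i-j∣+∣j-k∣ i j k =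
  subst (λ z → ∣ z ∣ ≤ ∣ i ℤ.- j ∣ + ∣ j ℤ.- k ∣) (telescope i j k) (ℤ.∣i+j∣≤∣i∣+∣j∣ (i ℤ.- j) (j ℤ.- k))
  where
  telescope : ∀ i j k → (i ℤ.- j) ℤ.+ (j ℤ.- k) ≡ i ℤ.- k
  telescope = ℤ-Solver.solve-∀

chebyshev-triangle : ∀ p q r → chebyshev p r ≤ chebyshev p q + chebyshev q r
chebyshev-triangle (x , y) (x′ , y′) (x″ , y″) = ⊔-lub
  (≤-trans (∣i-k∣≤∣i-j∣+∣j-k∣ x x′ x″)
             (+-mono-≤ (m≤m⊔n ∣ x ℤ.- x′ ∣ ∣ y ℤ.- y′ ∣) (m≤m⊔n ∣ x′ ℤ.- x″ ∣ ∣ y′ ℤ.- y″ ∣)))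
  (≤-trans (∣i-k∣≤∣i-j∣+∣j-k∣ y y′ y″)
             (+-mono-≤ (m≤n⊔m ∣ x ℤ.- x′ ∣ ∣ y ℤ.- y′ ∣) (m≤n⊔m ∣ x′ ℤ.- x″ ∣ ∣ y′ ℤ.- y″ ∣)))

chebyshev≤0⇒≡ : ∀ p q → chebyshev p q ≤ 0 → p ≡ q
chebyshev≤0⇒≡ (x , y) (x′ , y′) d≤0 = cong₂ _,_ (coordinate (m⊔n≤o⇒m≤o _ _ d≤0)) (coordinate (m⊔n≤o⇒n≤o _ _ d≤0))
  where
  coordinate : ∀ {i j} → ∣ i ℤ.- j ∣ ≤ 0 → i ≡ j
  coordinate {i} {j} h = ℤ.i-j≡0⇒i≡j i j (ℤ.∣i∣≡0⇒i≡0 (n≤0⇒n≡0 h))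

King⇒chebyshev≤1 : ∀ {p q} → King p q → chebyshev p q ≤ 1
King⇒chebyshev≤1 (_ , ∣Δx∣≤1 , ∣Δy∣≤1) = ⊔-lub ∣Δx∣≤1 ∣Δy∣≤1

chebyshev≤1⇒King : ∀ {p q} → p ≢ q → chebyshev p q ≤ 1 → King p q
chebyshev≤1⇒King p≢q d≤1 = p≢q , m⊔n≤o⇒m≤o _ _ d≤1 , m⊔n≤o⇒n≤o _ _ d≤1

King-sym : ∀ {p q} → King p q → King q p
King-sym {p} {q} pq = chebyshev≤1⇒King (λ q≡p → proj₁ pq (sym q≡p))
                                       (subst (_≤ 1) (chebyshev-sym p q) (King⇒chebyshev≤1 pq))

module _ {E : Point → Point → Set} (E⇒King : ∀ {p q} → E p q → King p q) where
  open Walk using ([]; _∷_)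

  chebyshev≤length : ∀ {p q m} → Walk E p q m → chebyshev p q ≤ m
  chebyshev≤length {p} [] = ≤-reflexive (chebyshev-refl p)
  chebyshev≤length {p} {q} (_∷_ {w = r} e w) =
    ≤-trans (chebyshev-triangle p r q) (+-mono-≤ (King⇒chebyshev≤1 (E⇒King e)) (chebyshev≤length w))

-- Nonexpansive maps into a Helly graph

module HellyExtension (G : Graph) (helly : Helly G)
  {P : Set} (_≟_ : DecidableEquality P) (ρ : P → P → ℕ)
  (ρ-sym : ∀ p q → ρ p q ≡ ρ q p) (ρ-refl : ∀ p → ρ p p ≡ 0)
  (ρ-triangle : ∀ p q r → ρ p r ≤ ρ p q + ρ q r) where

  open Graph G
  open Walk using ([]; _∷_)
  open import Data.List.Relation.Unary.All using ([]; _∷_)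

  WalkWithin : V G → V G → ℕ → Set
  WalkWithin x y r = ∃ λ m → Walk _~_ x y m × m ≤ r

  reverse-within : ∀ {x y r r′} → r ≡ r′ → WalkWithin x y r → WalkWithin y x r′
  reverse-within refl (m , w , m≤r) = m , reverseʷ ~-sym w , m≤r

  record PartialMap : Set₁ where
    field
      map          : P → V G
      dom          : P → Set
      nonexpansive : ∀ {p q} → dom p → dom q → WalkWithin (map p) (map q) (ρ p q)

  open PartialMap public

  _↦_∈_ : P → V G → PartialMap → Set
  p ↦ x ∈ φ = dom φ p × map φ p ≡ x

  _⊑_ : PartialMap → PartialMap → Set
  φ ⊑ ψ = ∀ {p x} → p ↦ x ∈ φ → p ↦ x ∈ ψ

  Assignment : Set
  Assignment = P × V G

  Compatible : List Assignment → Set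
  Compatible A = ∀ {p x q y} → (p , x) ∈ A → (q , y) ∈ A → WalkWithin x y (ρ p q)

  singleton : P → V G → PartialMap
  singleton u x = record { map = λ _ → x ; dom = _≡ u ; nonexpansive = λ _ _ → 0 , [] , z≤n }

  extend-with : (φ : PartialMap) (u : P) (x : V G) →
                (∀ {p y} → p ↦ y ∈ φ → WalkWithin y x (ρ p u)) →
                Σ PartialMap λ ψ → φ ⊑ ψ × u ↦ x ∈ ψ × (∀ {p y} → p ↦ y ∈ ψ → p ↦ y ∈ φ ⊎ (p ≡ u × y ≡ x))
  extend-with φ u x within = ψ , φ⊑ψ , (inj₁ refl , f-u) , only
    where
    f : P → V G
    f p with p ≟ u
    ... | yes _ = x
    ... | no _ = map φ p

    f-view : ∀ p → (p ≡ u × f p ≡ x) ⊎ (p ≢ u × f p ≡ map φ p)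
    f-view p with p ≟ u
    ... | yes p≡u = inj₁ (p≡u , refl)
    ... | no p≢u = inj₂ (p≢u , refl)

    f-u : f u ≡ x
    f-u with f-view u
    ... | inj₁ (_ , fu) = fu
    ... | inj₂ (u≢u , _) = ⊥-elim (u≢u refl)

    D : P → Set
    D p = p ≡ u ⊎ dom φ p

    old : ∀ {p} → D p → p ≢ u → dom φ p
    old (inj₁ p≡u) p≢u = ⊥-elim (p≢u p≡u)
    old (inj₂ p∈) _ = p∈

    ne : ∀ {p q} → D p → D q → WalkWithin (f p) (f q) (ρ p q)
    ne {p} {q} p∈ q∈ with f-view p | f-view q
    ... | inj₁ (refl , fp) | inj₁ (refl , _) rewrite fp = 0 , [] , z≤n
    ... | inj₁ (refl , fp) | inj₂ (q≢u , fq) rewrite fp | fq =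
      reverse-within (ρ-sym q p) (within (old q∈ q≢u , refl))
    ... | inj₂ (p≢u , fp) | inj₁ (refl , fq) rewrite fp | fq = within (old p∈ p≢u , refl)
    ... | inj₂ (p≢u , fp) | inj₂ (q≢u , fq) rewrite fp | fq = nonexpansive φ (old p∈ p≢u) (old q∈ q≢u)

    ψ : PartialMap
    ψ = record { map = f ; dom = D ; nonexpansive = ne }

    φ⊑ψ : φ ⊑ ψ
    φ⊑ψ {p} p↦y@(p∈ , refl) with f-view p
    ... | inj₂ (_ , fp) = inj₂ p∈ , fp
    ... | inj₁ (refl , fp) with within p↦y
    ...   | _ , w , m≤ρuu =
      inj₂ p∈ , trans fp (sym (walk-0⇒≡ (subst (Walk _~_ _ _) (n≤0⇒n≡0 (≤-trans m≤ρuu (≤-reflexive (ρ-refl p)))) w)))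

    only : ∀ {p y} → p ↦ y ∈ ψ → p ↦ y ∈ φ ⊎ (p ≡ u × y ≡ x)
    only {p} (p∈ , refl) with f-view p
    ... | inj₁ (p≡u , fp) = inj₂ (p≡u , fp)
    ... | inj₂ (p≢u , fp) = inj₁ (old p∈ p≢u , sym fp)

  seed : ∀ u x A → Compatible ((u , x) ∷ A) →
         Σ PartialMap λ φ → All (λ (p , y) → p ↦ y ∈ φ) ((u , x) ∷ A) × (∀ {p y} → p ↦ y ∈ φ → (p , y) ∈ (u , x) ∷ A)
  seed u x [] _ = singleton u x , (refl , refl) ∷ [] , λ { (refl , refl) → here refl }
  seed u x ((v , z) ∷ A) compatible with seed v z A (λ p∈ q∈ → compatible (there p∈) (there q∈))
  ... | φ , φ-assigns , φ-only with extend-with φ u x (λ p↦y → compatible (there (φ-only p↦y)) (here refl))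
  ... | ψ , φ⊑ψ , u↦x , ψ-only =
    ψ , u↦x ∷ All.map φ⊑ψ φ-assigns , ψ-assigned ∘ ψ-only
    where
    ψ-assigned : ∀ {p y} → p ↦ y ∈ φ ⊎ (p ≡ u × y ≡ x) → (p , y) ∈ (u , x) ∷ (v , z) ∷ A
    ψ-assigned (inj₁ p↦y) = there (φ-only p↦y)
    ψ-assigned (inj₂ (refl , refl)) = here refl

  -- The disks around the images map φ p of radius ρ p u pairwise intersect: a walk from map φ p
  -- to map φ q of length ≤ ρ p u + ρ u q splits at a vertex of both.
  extend-helly : (φ : PartialMap) (u : P) → Σ PartialMap λ ψ → φ ⊑ ψ × dom ψ u
  extend-helly φ u with helly (∃ (dom φ)) (λ (p , _) → map φ p) (λ (p , _) → ρ p u) intersecting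
    where
    disk : ∀ {x y m r} → Walk _~_ x y m → m ≤ r → InDisk G y x r
    disk w m≤r with shortest-walk G w
    ... | m′ , dist , m′≤m = m′ , dist , ≤-trans m′≤m m≤r

    intersecting : ∀ ((p , _) (q , _) : ∃ (dom φ)) →
                   ∃ λ y → InDisk G y (map φ p) (ρ p u) × InDisk G y (map φ q) (ρ q u)
    intersecting (p , p∈) (q , q∈) with nonexpansive φ p∈ q∈
    ... | m , w , m≤ with splitAtʷ (ρ p u) (ρ u q) w (≤-trans m≤ (ρ-triangle p u q))
    ... | y , (_ , w₁ , m₁≤) , (_ , w₂ , m₂≤) =
      y , disk w₁ m₁≤ , disk (reverseʷ ~-sym w₂) (≤-trans m₂≤ (≤-reflexive (ρ-sym u q)))
  ... | x , x∈disks with extend-with φ u x (λ { (p∈ , refl) → within (x∈disks (_ , p∈)) })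
    where
    within : ∀ {y r} → InDisk G x y r → WalkWithin y x r
    within (m , (w , _) , m≤r) = m , w , m≤r
  ... | ψ , φ⊑ψ , (u∈ψ , _) , _ = ψ , φ⊑ψ , u∈ψ

  extend-all : (φ : PartialMap) (us : List P) → Σ PartialMap λ ψ → φ ⊑ ψ × All (dom ψ) us
  extend-all φ [] = φ , id , []
  extend-all φ (u ∷ us) with extend-helly φ u
  ... | ψ , φ⊑ψ , u∈ψ with extend-all ψ us
  ... | χ , ψ⊑χ , us⊆χ = χ , ψ⊑χ ∘ φ⊑ψ , proj₁ (ψ⊑χ (u∈ψ , refl)) ∷ us⊆χ

  -- If x, y are D apart, p lies within hp of z and q within D − hq of w, then a walk from
  -- map φ p to map φ q of length m completes to a walk from x to y of length ≤ hp + m + (D − hq).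
  height-gap≤length : (φ : PartialMap) {z w : P} {x y : V G} {D : ℕ} → z ↦ x ∈ φ → w ↦ y ∈ φ →
         (∀ {m} → Walk _~_ x y m → D ≤ m) →
         ∀ {p q hp hq m} → dom φ p → dom φ q → ρ z p ≤ hp → ρ q w + hq ≤ D →
         Walk _~_ (map φ p) (map φ q) m → hq ≤ hp + m
  height-gap≤length φ {z} {w} {D = D} (z∈ , refl) (w∈ , refl) x-y-far {p} {q} {hp} {hq} {m} p∈ q∈ zp≤hp qw+hq≤D walk
    with nonexpansive φ z∈ p∈ | nonexpansive φ q∈ w∈
  ... | m₁ , w₁ , m₁≤ | m₂ , w₂ , m₂≤ = +-cancelʳ-≤ (ρ q w) hq (hp + m) (begin
    hq + ρ q w         ≡⟨ +-comm hq (ρ q w) ⟩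
    ρ q w + hq         ≤⟨ qw+hq≤D ⟩
    D                  ≤⟨ x-y-far (w₁ ++ʷ walk ++ʷ w₂) ⟩
    m₁ + (m + m₂)      ≤⟨ +-mono-≤ (≤-trans m₁≤ zp≤hp) (+-monoʳ-≤ m m₂≤) ⟩
    hp + (m + ρ q w)   ≡⟨ sym (+-assoc hp m (ρ q w)) ⟩
    hp + m + ρ q w     ∎)
    where open ≤-Reasoning

-- Geodesics by descent

module _ {P : Set} (E : P → P → Set) (ρ : P → P → ℕ) (R : P → Set) where
  open Walk using ([]; _∷_)

  CloserNeighbour : P → P → Set
  CloserNeighbour p q = ∃ λ r → R r × E p r × suc (ρ r q) ≤ ρ p q

  geodesic-by-descent : (∀ {p q} → E p q → E q p) → (∀ p q → ρ p q ≡ ρ q p) →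
                        (∀ {p q} → R p → R q → p ≡ q ⊎ CloserNeighbour p q ⊎ CloserNeighbour q p) →
                        ∀ {p q} → R p → R q → ∃ λ m → Walk E p q m × m ≤ ρ p q
  geodesic-by-descent E-sym ρ-sym descend {p} {q} p∈ q∈ = go (suc (ρ p q)) p∈ q∈ ≤-refl
    where
    flip-closer : ∀ {p q r} → suc (ρ r p) ≤ ρ q p → suc (ρ p r) ≤ ρ p q
    flip-closer {p} {q} {r} = subst₂ (λ a b → suc a ≤ b) (ρ-sym r p) (ρ-sym q p)

    go : ∀ n {p q} → R p → R q → ρ p q < n → ∃ λ m → Walk E p q m × m ≤ ρ p q
    go (suc n) {p} {q} p∈ q∈ (s≤s ρ≤n) with descend p∈ q∈
    ... | inj₁ refl = 0 , [] , z≤n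
    ... | inj₂ (inj₁ (r , r∈ , e , closer)) with go n r∈ q∈ (≤-trans closer ρ≤n)
    ...   | m , w , m≤ = suc m , e ∷ w , ≤-trans (s≤s m≤) closer
    go (suc n) {p} {q} p∈ q∈ (s≤s ρ≤n) | inj₂ (inj₂ (r , r∈ , e , closer))
      with go n p∈ r∈ (≤-trans (flip-closer closer) ρ≤n)
    ... | m , w , m≤ = suc m , subst (Walk E p q) (+-comm m 1) (w ++ʷ (E-sym e ∷ [])) ,
                       ≤-trans (s≤s m≤) (flip-closer closer)

∣-∣≤ : ∀ {m n d} → m ≤ n + d → n ≤ m + d → ∣ m - n ∣ ≤ d
∣-∣≤ {m} {n} m≤n+d n≤m+d with ≤-total m n
... | inj₁ m≤n = subst (_≤ _) (sym (m≤n⇒∣m-n∣≡n∸m m≤n)) (m≤n+o⇒m∸n≤o n m n≤m+d)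
... | inj₂ n≤m = subst (_≤ _) (sym (m≤n⇒∣n-m∣≡n∸m n≤m)) (m≤n+o⇒m∸n≤o m n m≤n+d)

∣-∣≤⁻ : ∀ {m n d} → ∣ m - n ∣ ≤ d → m ≤ n + d × n ≤ m + d
∣-∣≤⁻ {m} {n} ∣m-n∣≤d = ≤-trans (m≤n+∣m-n∣ m n) (+-monoʳ-≤ n ∣m-n∣≤d) ,
                        ≤-trans (m≤n+∣n-m∣ n m) (+-monoʳ-≤ m ∣m-n∣≤d)

∣-∣+≤ : ∀ m n o p → m + o ≤ n + p → n + o ≤ m + p → ∣ m - n ∣ + o ≤ p
∣-∣+≤ m n o p m+o≤n+p n+o≤m+p with ≤-total m n
... | inj₁ m≤n = subst (_≤ p) (trans (+-∸-comm o m≤n) (cong (_+ o) (sym (m≤n⇒∣m-n∣≡n∸m m≤n))))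
                       (m≤n+o⇒m∸n≤o (n + o) m n+o≤m+p)
... | inj₂ n≤m = subst (_≤ p) (trans (+-∸-comm o n≤m) (cong (_+ o) (sym (m≤n⇒∣n-m∣≡n∸m n≤m))))
                       (m≤n+o⇒m∸n≤o (m + o) n m+o≤n+p)

∣-∣≡ : ∀ {m n d} → m + d ≡ n → ∣ m - n ∣ ≡ d
∣-∣≡ {m} {d = d} refl = ∣m-m+n∣≡n m d

m+d≡n⇒m≤n : ∀ {m n} d → m + d ≡ n → m ≤ n
m+d≡n⇒m≤n {m} d refl = m≤m+n m d

≤-rearrange : ∀ {L R A B} s → A ≤ B → L + s + B ≡ R + A → L ≤ R
≤-rearrange {L} {R} {A} {B} s A≤B eq =
  +-cancelʳ-≤ B L R (≤-trans (+-monoˡ-≤ B (m≤m+n L s)) (≤-trans (≤-reflexive eq) (+-monoʳ-≤ R A≤B)))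

∣-∣≤-by : ∀ m n {d} s t → m + s ≡ n + d → n + t ≡ m + d → ∣ m - n ∣ ≤ d
∣-∣≤-by _ _ s t eq₁ eq₂ = ∣-∣≤ (m+d≡n⇒m≤n s eq₁) (m+d≡n⇒m≤n t eq₂)

n+n≤1+m+m⇒n≤m : ∀ {m n} → n + n ≤ suc (m + m) → n ≤ m
n+n≤1+m+m⇒n≤m {m} {n} h with n ≤? m
... | yes n≤m = n≤m
... | no n≰m = ⊥-elim (<⇒≱ (≤-trans (≤-reflexive (cong suc (sym (+-suc m m)))) (+-mono-≤ m<n m<n)) h)
  where
  m<n : m < n
  m<n = ≰⇒> n≰m

⊔-≡ˡ : ∀ {a b d} → a ≡ d → b ≤ d → a ⊔ b ≡ d
⊔-≡ˡ refl b≤a = m≥n⇒m⊔n≡m b≤a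

⊔-≡ʳ : ∀ {a b d} → a ≤ d → b ≡ d → a ⊔ b ≡ d
⊔-≡ʳ a≤b refl = m≤n⇒m⊔n≡n a≤b

ℕ² : Set
ℕ² = ℕ × ℕ

chebyshevℕ : ℕ² → ℕ² → ℕ
chebyshevℕ (X , Y) (X′ , Y′) = ∣ X - X′ ∣ ⊔ ∣ Y - Y′ ∣

chebyshevℕ-sym : ∀ p q → chebyshevℕ p q ≡ chebyshevℕ q p
chebyshevℕ-sym (X , Y) (X′ , Y′) = cong₂ _⊔_ (∣-∣-comm X X′) (∣-∣-comm Y Y′)

chebyshevℕ-refl : ∀ p → chebyshevℕ p p ≡ 0
chebyshevℕ-refl (X , Y) = cong₂ _⊔_ (∣n-n∣≡0 X) (∣n-n∣≡0 Y)

chebyshevℕ-triangle : ∀ p q r → chebyshevℕ p r ≤ chebyshevℕ p q + chebyshevℕ q r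
chebyshevℕ-triangle (X , Y) (X′ , Y′) (X″ , Y″) = ⊔-lub
  (≤-trans (∣-∣-triangle X X′ X″) (+-mono-≤ (m≤m⊔n ∣ X - X′ ∣ ∣ Y - Y′ ∣) (m≤m⊔n ∣ X′ - X″ ∣ ∣ Y′ - Y″ ∣)))
  (≤-trans (∣-∣-triangle Y Y′ Y″) (+-mono-≤ (m≤n⊔m ∣ X - X′ ∣ ∣ Y - Y′ ∣) (m≤n⊔m ∣ X′ - X″ ∣ ∣ Y′ - Y″ ∣)))

chebyshevℕ≤0⇒≡ : ∀ p q → chebyshevℕ p q ≤ 0 → p ≡ q
chebyshevℕ≤0⇒≡ (X , Y) (X′ , Y′) d≤0 =
  cong₂ _,_ (∣m-n∣≡0⇒m≡n (n≤0⇒n≡0 (m⊔n≤o⇒m≤o _ _ d≤0))) (∣m-n∣≡0⇒m≡n (n≤0⇒n≡0 (m⊔n≤o⇒n≤o _ _ d≤0)))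

Adjacent : ℕ² → ℕ² → Set
Adjacent p q = p ≢ q × chebyshevℕ p q ≤ 1

data Toward : ℕ → ℕ → ℕ → Set where
  stay : ∀ {X} → Toward X X X
  up   : ∀ {X X′} → X < X′ → Toward X X′ (suc X)
  down : ∀ {X X′} → X′ ≤ X → Toward (suc X) X′ X

toward : ∀ X X′ → ∃ (Toward X X′)
toward zero zero = _ , stay
toward zero (suc X′) = _ , up (s≤s z≤n)
toward (suc X) zero = _ , down z≤n
toward (suc X) (suc X′) with toward X X′
... | _ , stay = _ , stay
... | _ , up X<X′ = _ , up (s≤s X<X′)
... | _ , down X′≤X = _ , down (s≤s X′≤X)

toward-adjacent : ∀ {X X′ X″} → Toward X X′ X″ → ∣ X - X″ ∣ ≤ 1
toward-adjacent {X} stay = ≤-trans (≤-reflexive (∣n-n∣≡0 X)) z≤n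
toward-adjacent {X} (up _) = ≤-reflexive (∣-∣≡ (+-comm X 1))
toward-adjacent {suc X} (down _) = ≤-reflexive (trans (∣-∣-comm (suc X) X) (∣-∣≡ (+-comm X 1)))

toward-closer : ∀ {X X′ X″ n} → Toward X X′ X″ → ∣ X - X′ ∣ ≤ suc n → ∣ X″ - X′ ∣ ≤ n
toward-closer {X} stay _ = ≤-trans (≤-reflexive (∣n-n∣≡0 X)) z≤n
toward-closer {X} {X′} {n = n} (up X<X′) ∣X-X′∣≤1+n =
  ∣-∣≤ (≤-trans X<X′ (m≤m+n X′ n)) (≤-trans (proj₂ (∣-∣≤⁻ ∣X-X′∣≤1+n)) (≤-reflexive (+-suc X n)))
toward-closer {suc X} {X′} {n = n} (down X′≤X) ∣X-X′∣≤1+n =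
  ∣-∣≤ (≤-pred (≤-trans (proj₁ (∣-∣≤⁻ ∣X-X′∣≤1+n)) (≤-reflexive (+-suc X′ n)))) (≤-trans X′≤X (m≤m+n X n))

toward-fixed : ∀ {X X′} → Toward X X′ X → X ≡ X′
toward-fixed stay = refl

toward-preserves-sum≥ : ∀ {A X X′ X″ Y Y′ Y″} → A ≤ X + Y → A ≤ X′ + Y′ →
                        Toward X X′ X″ → Toward Y Y′ Y″ → A ≤ X″ + Y″
toward-preserves-sum≥ h h′ stay stay = h
toward-preserves-sum≥ {X = X} {Y = Y} h h′ stay (up _) = ≤-trans h (+-monoʳ-≤ X (n≤1+n Y))
toward-preserves-sum≥ {X = X} h h′ stay (down Y′≤Y″) = ≤-trans h′ (+-monoʳ-≤ X Y′≤Y″)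
toward-preserves-sum≥ {X = X} {Y = Y} h h′ (up _) stay = ≤-trans h (+-monoˡ-≤ Y (n≤1+n X))
toward-preserves-sum≥ {X = X} {Y = Y} h h′ (up _) (up _) = ≤-trans h (+-mono-≤ (n≤1+n X) (n≤1+n Y))
toward-preserves-sum≥ {X = X} {Y″ = Y″} h h′ (up _) (down _) = ≤-trans h (≤-reflexive (+-suc X Y″))
toward-preserves-sum≥ {Y = Y} h h′ (down X′≤X″) stay = ≤-trans h′ (+-monoˡ-≤ Y X′≤X″)
toward-preserves-sum≥ {X″ = X″} {Y = Y} h h′ (down _) (up _) = ≤-trans h (≤-reflexive (sym (+-suc X″ Y)))
toward-preserves-sum≥ h h′ (down X′≤X″) (down Y′≤Y″) = ≤-trans h′ (+-mono-≤ X′≤X″ Y′≤Y″)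

toward-preserves-sum≤ : ∀ {B X X′ X″ Y Y′ Y″} → X + Y ≤ B → X′ + Y′ ≤ B →
                        Toward X X′ X″ → Toward Y Y′ Y″ → X″ + Y″ ≤ B
toward-preserves-sum≤ h h′ stay stay = h
toward-preserves-sum≤ {X = X} h h′ stay (up Y<Y′) = ≤-trans (+-monoʳ-≤ X Y<Y′) h′
toward-preserves-sum≤ {X = X} {Y″ = Y″} h h′ stay (down _) = ≤-trans (+-monoʳ-≤ X (n≤1+n Y″)) h
toward-preserves-sum≤ {Y = Y} h h′ (up X<X′) stay = ≤-trans (+-monoˡ-≤ Y X<X′) h′
toward-preserves-sum≤ h h′ (up X<X′) (up Y<Y′) = ≤-trans (+-mono-≤ X<X′ Y<Y′) h′
toward-preserves-sum≤ {X = X} {Y″ = Y″} h h′ (up _) (down _) = ≤-trans (≤-reflexive (sym (+-suc X Y″))) h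
toward-preserves-sum≤ {X″ = X″} {Y = Y} h h′ (down _) stay = ≤-trans (+-monoˡ-≤ Y (n≤1+n X″)) h
toward-preserves-sum≤ {X″ = X″} {Y = Y} h h′ (down _) (up _) = ≤-trans (≤-reflexive (+-suc X″ Y)) h
toward-preserves-sum≤ {X″ = X″} {Y″ = Y″} h h′ (down _) (down _) = ≤-trans (+-mono-≤ (n≤1+n X″) (n≤1+n Y″)) h

toward-preserves-diff : ∀ {e X X′ X″ Y Y′ Y″} → Y ≤ X + e → Y′ ≤ X′ + e →
                        Toward X X′ X″ → Toward Y Y′ Y″ → Y″ ≤ X″ + e
toward-preserves-diff h h′ stay stay = h
toward-preserves-diff h h′ stay (up Y<Y′) = ≤-trans Y<Y′ h′
toward-preserves-diff {Y″ = Y″} h h′ stay (down _) = ≤-trans (n≤1+n Y″) h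
toward-preserves-diff {e} {X = X} h h′ (up _) stay = ≤-trans h (+-monoˡ-≤ e (n≤1+n X))
toward-preserves-diff h h′ (up _) (up _) = s≤s h
toward-preserves-diff {e} {X = X} {Y″ = Y″} h h′ (up _) (down _) =
  ≤-trans (n≤1+n Y″) (≤-trans h (+-monoˡ-≤ e (n≤1+n X)))
toward-preserves-diff {e} h h′ (down X′≤X″) stay = ≤-trans h′ (+-monoˡ-≤ e X′≤X″)
toward-preserves-diff {e} h h′ (down X′≤X″) (up Y<Y′) = ≤-trans Y<Y′ (≤-trans h′ (+-monoˡ-≤ e X′≤X″))
toward-preserves-diff h h′ (down _) (down _) = ≤-pred h

-- H₃^{k,l} in natural coordinates

module Region (k l : ℕ) where

  -- Through toPoint, Bulk is the strip 0 ≤ s ≤ 2k+2, −1 ≤ t ≤ 2l+1 of H₃^{k,l}; the corners are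
  -- its four remaining points.
  Bulk : ℕ² → Set
  Bulk (X , Y) = l + 2 ≤ X + Y × X + Y ≤ k + k + l + 4 × Y ≤ X + suc l × X ≤ Y + suc l

  CloserBulkNeighbour : ℕ² → ℕ² → Set
  CloserBulkNeighbour p q = ∃ λ r → Bulk r × Adjacent p r × suc (chebyshevℕ r q) ≤ chebyshevℕ p q

  bulk-step : ∀ {p q} → Bulk p → Bulk q → p ≢ q → CloserBulkNeighbour p q
  bulk-step {p@(X , Y)} {q@(P , Q)} (p₁ , p₂ , p₃ , p₄) (q₁ , q₂ , q₃ , q₄) p≢q
    with toward X P | toward Y Q | chebyshevℕ p q in d≡
  ... | _ | _ | zero = ⊥-elim (p≢q (chebyshevℕ≤0⇒≡ p q (≤-reflexive d≡)))
  ... | X″ , X→P | Y″ , Y→Q | suc n = (X″ , Y″) , bulk , (p≢r , ⊔-lub (toward-adjacent X→P) (toward-adjacent Y→Q)) ,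
        s≤s (⊔-lub (toward-closer X→P (≤-trans (m≤m⊔n ∣ X - P ∣ ∣ Y - Q ∣) (≤-reflexive d≡)))
                   (toward-closer Y→Q (≤-trans (m≤n⊔m ∣ X - P ∣ ∣ Y - Q ∣) (≤-reflexive d≡))))
    where
    bulk : Bulk (X″ , Y″)
    bulk = toward-preserves-sum≥ p₁ q₁ X→P Y→Q , toward-preserves-sum≤ p₂ q₂ X→P Y→Q ,
           toward-preserves-diff p₃ q₃ X→P Y→Q , toward-preserves-diff p₄ q₄ Y→Q X→P
    p≢r : p ≢ (X″ , Y″)
    p≢r refl = p≢q (cong₂ _,_ (toward-fixed X→P) (toward-fixed Y→Q))

  cornerA cornerB cornerC cornerD : ℕ²
  cornerA = (l + 1 , 0)
  cornerB = (0 , l + 2)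
  cornerC = (k + 2 , k + l + 3)
  cornerD = (k + l + 3 , k + 1)

  chebyshevℕ-AB : chebyshevℕ cornerA cornerB ≡ l + 2
  chebyshevℕ-AB = ⊔-≡ʳ (∣-∣≤-by (l + 1) 0 1 (l + l + 3) (solve (l ∷ [])) (solve (l ∷ []))) refl

  chebyshevℕ-AC : chebyshevℕ cornerA cornerC ≡ k + l + 3
  chebyshevℕ-AC = ⊔-≡ʳ (∣-∣≤-by (l + 1) (k + 2) (k + k + 4) (l + l + 2) (solve (k ∷ l ∷ [])) (solve (k ∷ l ∷ []))) refl

  chebyshevℕ-AD : chebyshevℕ cornerA cornerD ≡ k + 2
  chebyshevℕ-AD = ⊔-≡ˡ (∣-∣≡ {l + 1} {k + l + 3} (solve (k ∷ l ∷ [])))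
                       (∣-∣≤-by 0 (k + 1) (k + k + 3) 1 (solve (k ∷ [])) (solve (k ∷ [])))

  chebyshevℕ-BC : chebyshevℕ cornerB cornerC ≡ k + 2
  chebyshevℕ-BC = ⊔-≡ˡ refl (∣-∣≤-by (l + 2) (k + l + 3) (k + k + 3) 1 (solve (k ∷ l ∷ [])) (solve (k ∷ l ∷ [])))

  chebyshevℕ-BD : chebyshevℕ cornerB cornerD ≡ k + l + 3
  chebyshevℕ-BD = ⊔-≡ˡ refl (∣-∣≤-by (l + 2) (k + 1) (k + k + 2) (l + l + 4) (solve (k ∷ l ∷ [])) (solve (k ∷ l ∷ [])))

  chebyshevℕ-CD : chebyshevℕ cornerC cornerD ≡ l + 2
  chebyshevℕ-CD = ⊔-≡ʳ (∣-∣≤-by (k + 2) (k + l + 3) (l + l + 3) 1 (solve (k ∷ l ∷ [])) (solve (k ∷ l ∷ [])))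
                       (trans (∣-∣-comm (k + l + 3) (k + 1)) (∣-∣≡ {k + 1} {k + l + 3} (solve (k ∷ l ∷ []))))

  -- Stated for half-planes rather than for Bulk, so that they also give the steps between corners.
  step-from-A : ∀ {P Q} → l + 2 ≤ P + Q → P ≤ Q + suc l → CloserBulkNeighbour cornerA (P , Q)
  step-from-A {P} {zero} h₁ h₄ = ⊥-elim (1+n≰n (subst (_≤ suc l) (+-comm l 2) (≤-trans h₁ (≤-rearrange 0 h₄ (solve (P ∷ l ∷ []))))))
  step-from-A {P} {suc Q} h₁ h₄ with P ≤? (l + 1) + Q
  ... | yes P≤ = (l + 1 , 1) , bulk , adjacent , ≤-trans (s≤s (⊔-lub (∣-∣≤ l+1≤ P≤) ≤-refl)) (m≤n⊔m ∣ l + 1 - P ∣ (suc Q))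
    where
    l+1≤ : l + 1 ≤ P + Q
    l+1≤ = ≤-rearrange 0 h₁ (solve (P ∷ Q ∷ l ∷ []))
    bulk : Bulk (l + 1 , 1)
    bulk = m+d≡n⇒m≤n 0 (solve (l ∷ [])) , m+d≡n⇒m≤n (k + k + 2) (solve (k ∷ l ∷ [])) ,
           m+d≡n⇒m≤n (l + l + 1) (solve (l ∷ [])) , m+d≡n⇒m≤n 1 (solve (l ∷ []))
    adjacent : Adjacent cornerA (l + 1 , 1)
    adjacent = (λ ()) ∘ ,-injectiveʳ , ⊔-lub (∣-∣≤-by (l + 1) (l + 1) 1 1 (solve (l ∷ [])) (solve (l ∷ []))) ≤-refl
  ... | no P≰ = (l + 2 , 1) , bulk , adjacent , ≤-trans (s≤s (⊔-lub (∣-∣≤ l+2≤ P≤) ≤-refl)) (m≤n⊔m ∣ l + 1 - P ∣ (suc Q))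
    where
    l+2≤ : l + 2 ≤ P + Q
    l+2≤ = ≤-trans (m+d≡n⇒m≤n {n = suc (l + 1 + Q)} Q (solve (Q ∷ l ∷ []))) (≤-trans (≰⇒> P≰) (m≤m+n P Q))
    P≤ : P ≤ l + 2 + Q
    P≤ = ≤-rearrange 0 h₄ (solve (P ∷ Q ∷ l ∷ []))
    bulk : Bulk (l + 2 , 1)
    bulk = m+d≡n⇒m≤n 1 (solve (l ∷ [])) , m+d≡n⇒m≤n (k + k + 1) (solve (k ∷ l ∷ [])) ,
           m+d≡n⇒m≤n (l + l + 2) (solve (l ∷ [])) , m+d≡n⇒m≤n 0 (solve (l ∷ []))
    adjacent : Adjacent cornerA (l + 2 , 1)
    adjacent = (λ ()) ∘ ,-injectiveʳ , ⊔-lub (∣-∣≤-by (l + 1) (l + 2) 2 0 (solve (l ∷ [])) (solve (l ∷ []))) ≤-refl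

  step-from-B : ∀ {P Q} → l + 2 ≤ P + Q → Q ≤ P + suc l → CloserBulkNeighbour cornerB (P , Q)
  step-from-B {zero} {Q} h₁ h₃ = ⊥-elim (1+n≰n (subst (_≤ suc l) (+-comm l 2) (≤-trans h₁ h₃)))
  step-from-B {suc P} {Q} h₁ h₃ with Q ≤? (l + 1) + P
  ... | yes Q≤ = (1 , l + 1) , bulk , adjacent , ≤-trans (s≤s (⊔-lub ≤-refl (∣-∣≤ l+1≤ Q≤))) (m≤m⊔n (suc P) ∣ l + 2 - Q ∣)
    where
    l+1≤ : l + 1 ≤ Q + P
    l+1≤ = ≤-rearrange 0 h₁ (solve (P ∷ Q ∷ l ∷ []))
    bulk : Bulk (1 , l + 1)
    bulk = m+d≡n⇒m≤n 0 (solve (l ∷ [])) , m+d≡n⇒m≤n (k + k + 2) (solve (k ∷ l ∷ [])) ,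
           m+d≡n⇒m≤n 1 (solve (l ∷ [])) , m+d≡n⇒m≤n (l + l + 1) (solve (l ∷ []))
    adjacent : Adjacent cornerB (1 , l + 1)
    adjacent = (λ ()) ∘ ,-injectiveˡ , ⊔-lub ≤-refl (∣-∣≤-by (l + 2) (l + 1) 0 2 (solve (l ∷ [])) (solve (l ∷ [])))
  ... | no Q≰ = (1 , l + 2) , bulk , adjacent , ≤-trans (s≤s (⊔-lub ≤-refl (∣-∣≤ l+2≤ Q≤))) (m≤m⊔n (suc P) ∣ l + 2 - Q ∣)
    where
    l+2≤ : l + 2 ≤ Q + P
    l+2≤ = ≤-trans (m+d≡n⇒m≤n {n = suc (l + 1 + P)} P (solve (P ∷ l ∷ []))) (≤-trans (≰⇒> Q≰) (m≤m+n Q P))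
    Q≤ : Q ≤ l + 2 + P
    Q≤ = ≤-rearrange 0 h₃ (solve (P ∷ Q ∷ l ∷ []))
    bulk : Bulk (1 , l + 2)
    bulk = m+d≡n⇒m≤n 1 (solve (l ∷ [])) , m+d≡n⇒m≤n (k + k + 1) (solve (k ∷ l ∷ [])) ,
           m+d≡n⇒m≤n 0 (solve (l ∷ [])) , m+d≡n⇒m≤n (l + l + 2) (solve (l ∷ []))
    adjacent : Adjacent cornerB (1 , l + 2)
    adjacent = (λ ()) ∘ ,-injectiveˡ , ⊔-lub ≤-refl (∣-∣≤-by (l + 2) (l + 2) 1 1 (solve (l ∷ [])) (solve (l ∷ [])))

  step-from-C : ∀ {P Q} → P + Q ≤ k + k + l + 4 → Q ≤ P + suc l → CloserBulkNeighbour cornerC (P , Q)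
  step-from-C {P} {Q} g₂ g₃ = via-gap (m≤n⇒∃[o]m+o≡n Q≤k+l+2)
    where
    Q≤k+l+2 : Q ≤ k + l + 2
    Q≤k+l+2 = n+n≤1+m+m⇒n≤m (≤-rearrange 0 (+-mono-≤ g₂ g₃) (solve (P ∷ Q ∷ k ∷ l ∷ [])))

    Y≤ : ∀ {D} → Q + D ≡ k + l + 2 → ∣ k + l + 2 - Q ∣ ≤ D
    Y≤ {D} Q+D≡ = ∣-∣≤ (≤-reflexive (sym Q+D≡)) (≤-trans (m≤m+n Q D) (≤-trans (≤-reflexive Q+D≡) (m≤m+n (k + l + 2) D)))

    gap<chebyshevℕ : ∀ {D} → Q + D ≡ k + l + 2 → suc D ≤ chebyshevℕ cornerC (P , Q)
    gap<chebyshevℕ {D} Q+D≡ = ≤-trans (≤-reflexive (sym (trans (∣-∣-comm (k + l + 3) Q) (∣-∣≡ Q+sucD≡))))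
                           (m≤n⊔m ∣ k + 2 - P ∣ ∣ k + l + 3 - Q ∣)
      where
      Q+sucD≡ : Q + suc D ≡ k + l + 3
      Q+sucD≡ = trans (+-suc Q D) (trans (cong suc Q+D≡) (solve (k ∷ l ∷ [])))

    via-gap : (∃ λ D → Q + D ≡ k + l + 2) → CloserBulkNeighbour cornerC (P , Q)
    via-gap (D , Q+D≡) with Q ≤? P + l
    ... | yes Q≤ = (k + 2 , k + l + 2) , bulk , adjacent , ≤-trans (s≤s (⊔-lub (∣-∣≤ k+2≤ P≤) (Y≤ Q+D≡))) (gap<chebyshevℕ Q+D≡)
      where
      k+2≤ : k + 2 ≤ P + D
      k+2≤ = ≤-rearrange 0 (+-mono-≤ Q≤ (≤-reflexive (sym Q+D≡))) (solve (P ∷ Q ∷ D ∷ k ∷ l ∷ []))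
      P≤ : P ≤ k + 2 + D
      P≤ = ≤-rearrange 0 (+-mono-≤ g₂ (≤-reflexive (sym Q+D≡))) (solve (P ∷ Q ∷ D ∷ k ∷ l ∷ []))
      bulk : Bulk (k + 2 , k + l + 2)
      bulk = m+d≡n⇒m≤n (k + k + 2) (solve (k ∷ l ∷ [])) , m+d≡n⇒m≤n 0 (solve (k ∷ l ∷ [])) ,
             m+d≡n⇒m≤n 1 (solve (k ∷ l ∷ [])) , m+d≡n⇒m≤n (l + l + 1) (solve (k ∷ l ∷ []))
      adjacent : Adjacent cornerC (k + 2 , k + l + 2)
      adjacent = >⇒≢ (m+d≡n⇒m≤n {suc (k + l + 2)} {k + l + 3} 0 (solve (k ∷ l ∷ []))) ∘ ,-injectiveʳ ,
                 ⊔-lub (∣-∣≤-by (k + 2) (k + 2) 1 1 (solve (k ∷ [])) (solve (k ∷ [])))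
                       (∣-∣≤-by (k + l + 3) (k + l + 2) 0 2 (solve (k ∷ l ∷ [])) (solve (k ∷ l ∷ [])))
    ... | no Q≰ = (k + 1 , k + l + 2) , bulk , adjacent , ≤-trans (s≤s (⊔-lub (∣-∣≤ k+1≤ P≤) (Y≤ Q+D≡))) (gap<chebyshevℕ Q+D≡)
      where
      k+1≤ : k + 1 ≤ P + D
      k+1≤ = ≤-rearrange 0 (+-mono-≤ g₃ (≤-reflexive (sym Q+D≡))) (solve (P ∷ Q ∷ D ∷ k ∷ l ∷ []))
      P≤ : P ≤ k + 1 + D
      P≤ = ≤-trans (n+n≤1+m+m⇒n≤m {k + 1} (≤-rearrange 0 (+-mono-≤ (≰⇒> Q≰) g₂) (solve (P ∷ Q ∷ k ∷ l ∷ []))))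
                   (m≤m+n (k + 1) D)
      bulk : Bulk (k + 1 , k + l + 2)
      bulk = m+d≡n⇒m≤n (k + k + 1) (solve (k ∷ l ∷ [])) , m+d≡n⇒m≤n 1 (solve (k ∷ l ∷ [])) ,
             m+d≡n⇒m≤n 0 (solve (k ∷ l ∷ [])) , m+d≡n⇒m≤n (l + l + 2) (solve (k ∷ l ∷ []))
      adjacent : Adjacent cornerC (k + 1 , k + l + 2)
      adjacent = >⇒≢ (m+d≡n⇒m≤n {suc (k + l + 2)} {k + l + 3} 0 (solve (k ∷ l ∷ []))) ∘ ,-injectiveʳ ,
                 ⊔-lub (∣-∣≤-by (k + 2) (k + 1) 0 2 (solve (k ∷ [])) (solve (k ∷ [])))
                       (∣-∣≤-by (k + l + 3) (k + l + 2) 0 2 (solve (k ∷ l ∷ [])) (solve (k ∷ l ∷ [])))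

  step-from-D : ∀ {P Q} → P + Q ≤ k + k + l + 4 → P ≤ Q + suc l → CloserBulkNeighbour cornerD (P , Q)
  step-from-D {P} {Q} g₂ g₄ = via-gap (m≤n⇒∃[o]m+o≡n P≤k+l+2)
    where
    P≤k+l+2 : P ≤ k + l + 2
    P≤k+l+2 = n+n≤1+m+m⇒n≤m (≤-rearrange 0 (+-mono-≤ g₂ g₄) (solve (P ∷ Q ∷ k ∷ l ∷ [])))

    X≤ : ∀ {D} → P + D ≡ k + l + 2 → ∣ k + l + 2 - P ∣ ≤ D
    X≤ {D} P+D≡ = ∣-∣≤ (≤-reflexive (sym P+D≡)) (≤-trans (m≤m+n P D) (≤-trans (≤-reflexive P+D≡) (m≤m+n (k + l + 2) D)))

    gap<chebyshevℕ : ∀ {D} → P + D ≡ k + l + 2 → suc D ≤ chebyshevℕ cornerD (P , Q)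
    gap<chebyshevℕ {D} P+D≡ = ≤-trans (≤-reflexive (sym (trans (∣-∣-comm (k + l + 3) P) (∣-∣≡ P+sucD≡))))
                           (m≤m⊔n ∣ k + l + 3 - P ∣ ∣ k + 1 - Q ∣)
      where
      P+sucD≡ : P + suc D ≡ k + l + 3
      P+sucD≡ = trans (+-suc P D) (trans (cong suc P+D≡) (solve (k ∷ l ∷ [])))

    via-gap : (∃ λ D → P + D ≡ k + l + 2) → CloserBulkNeighbour cornerD (P , Q)
    via-gap (D , P+D≡) with P ≤? Q + l
    ... | yes P≤ = (k + l + 2 , k + 2) , bulk , adjacent , ≤-trans (s≤s (⊔-lub (X≤ P+D≡) (∣-∣≤ k+2≤ Q≤))) (gap<chebyshevℕ P+D≡)
      where
      k+2≤ : k + 2 ≤ Q + D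
      k+2≤ = ≤-rearrange 0 (+-mono-≤ P≤ (≤-reflexive (sym P+D≡))) (solve (P ∷ Q ∷ D ∷ k ∷ l ∷ []))
      Q≤ : Q ≤ k + 2 + D
      Q≤ = ≤-rearrange 0 (+-mono-≤ g₂ (≤-reflexive (sym P+D≡))) (solve (P ∷ Q ∷ D ∷ k ∷ l ∷ []))
      bulk : Bulk (k + l + 2 , k + 2)
      bulk = m+d≡n⇒m≤n (k + k + 2) (solve (k ∷ l ∷ [])) , m+d≡n⇒m≤n 0 (solve (k ∷ l ∷ [])) ,
             m+d≡n⇒m≤n (l + l + 1) (solve (k ∷ l ∷ [])) , m+d≡n⇒m≤n 1 (solve (k ∷ l ∷ []))
      adjacent : Adjacent cornerD (k + l + 2 , k + 2)
      adjacent = >⇒≢ (m+d≡n⇒m≤n {suc (k + l + 2)} {k + l + 3} 0 (solve (k ∷ l ∷ []))) ∘ ,-injectiveˡ ,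
                 ⊔-lub (∣-∣≤-by (k + l + 3) (k + l + 2) 0 2 (solve (k ∷ l ∷ [])) (solve (k ∷ l ∷ [])))
                       (∣-∣≤-by (k + 1) (k + 2) 2 0 (solve (k ∷ [])) (solve (k ∷ [])))
    ... | no P≰ = (k + l + 2 , k + 1) , bulk , adjacent , ≤-trans (s≤s (⊔-lub (X≤ P+D≡) (∣-∣≤ k+1≤ Q≤))) (gap<chebyshevℕ P+D≡)
      where
      k+1≤ : k + 1 ≤ Q + D
      k+1≤ = ≤-rearrange 0 (+-mono-≤ g₄ (≤-reflexive (sym P+D≡))) (solve (P ∷ Q ∷ D ∷ k ∷ l ∷ []))
      Q≤ : Q ≤ k + 1 + D
      Q≤ = ≤-trans (n+n≤1+m+m⇒n≤m {k + 1} (≤-rearrange 0 (+-mono-≤ (≰⇒> P≰) g₂) (solve (P ∷ Q ∷ k ∷ l ∷ []))))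
                   (m≤m+n (k + 1) D)
      bulk : Bulk (k + l + 2 , k + 1)
      bulk = m+d≡n⇒m≤n (k + k + 1) (solve (k ∷ l ∷ [])) , m+d≡n⇒m≤n 1 (solve (k ∷ l ∷ [])) ,
             m+d≡n⇒m≤n (l + l + 2) (solve (k ∷ l ∷ [])) , m+d≡n⇒m≤n 0 (solve (k ∷ l ∷ []))
      adjacent : Adjacent cornerD (k + l + 2 , k + 1)
      adjacent = >⇒≢ (m+d≡n⇒m≤n {suc (k + l + 2)} {k + l + 3} 0 (solve (k ∷ l ∷ []))) ∘ ,-injectiveˡ ,
                 ⊔-lub (∣-∣≤-by (k + l + 3) (k + l + 2) 0 2 (solve (k ∷ l ∷ [])) (solve (k ∷ l ∷ [])))
                       (∣-∣≤-by (k + 1) (k + 1) 1 1 (solve (k ∷ [])) (solve (k ∷ [])))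

  bulk-bounded : ∀ {P Q} → Bulk (P , Q) → P ≤ k + l + 2 × Q ≤ k + l + 2
  bulk-bounded {P} {Q} (_ , q₂ , q₃ , q₄) =
    n+n≤1+m+m⇒n≤m (≤-rearrange 0 (+-mono-≤ q₂ q₄) (solve (P ∷ Q ∷ k ∷ l ∷ []))) ,
    n+n≤1+m+m⇒n≤m (≤-rearrange 0 (+-mono-≤ q₂ q₃) (solve (P ∷ Q ∷ k ∷ l ∷ [])))

  chebyshevℕ-A≤Y : ∀ {P Q} → Bulk (P , Q) → chebyshevℕ cornerA (P , Q) ≤ Q
  chebyshevℕ-A≤Y {P} {Q} (q₁ , _ , _ , q₄) =
    ⊔-lub (∣-∣≤ {l + 1} {P} {Q} (≤-rearrange 1 q₁ (solve (P ∷ Q ∷ l ∷ [])))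
                                (≤-rearrange 0 q₄ (solve (P ∷ Q ∷ l ∷ []))))
          ≤-refl

  chebyshevℕ-B≤X : ∀ {P Q} → Bulk (P , Q) → chebyshevℕ cornerB (P , Q) ≤ P
  chebyshevℕ-B≤X {P} {Q} (q₁ , _ , q₃ , _) =
    ⊔-lub ≤-refl (∣-∣≤ {l + 2} {Q} {P} (≤-rearrange 0 q₁ (solve (P ∷ Q ∷ l ∷ [])))
                                       (≤-rearrange 1 q₃ (solve (P ∷ Q ∷ l ∷ []))))

  chebyshevℕ-C+Y≤ : ∀ {P Q} → Bulk (P , Q) → chebyshevℕ (P , Q) cornerC + Q ≤ k + l + 3
  chebyshevℕ-C+Y≤ {P} {Q} (_ , q₂ , q₃ , _) =
    subst (_≤ k + l + 3) (sym (+-distribʳ-⊔ Q ∣ P - (k + 2) ∣ ∣ Q - (k + l + 3) ∣)) (⊔-lub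
      (∣-∣+≤ P (k + 2) Q (k + l + 3) (≤-rearrange 1 q₂ (solve (P ∷ Q ∷ k ∷ l ∷ [])))
                                     (≤-rearrange 0 q₃ (solve (P ∷ Q ∷ k ∷ l ∷ []))))
      (∣-∣+≤ Q (k + l + 3) Q (k + l + 3) (≤-rearrange 1 (+-mono-≤ q₂ q₃) (solve (P ∷ Q ∷ k ∷ l ∷ [])))
                                         (≤-reflexive (+-comm (k + l + 3) Q))))

  chebyshevℕ-D+X≤ : ∀ {P Q} → Bulk (P , Q) → chebyshevℕ (P , Q) cornerD + P ≤ k + l + 3
  chebyshevℕ-D+X≤ {P} {Q} (_ , q₂ , _ , q₄) =
    subst (_≤ k + l + 3) (sym (+-distribʳ-⊔ P ∣ P - (k + l + 3) ∣ ∣ Q - (k + 1) ∣)) (⊔-lub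
      (∣-∣+≤ P (k + l + 3) P (k + l + 3) (≤-rearrange 1 (+-mono-≤ q₂ q₄) (solve (P ∷ Q ∷ k ∷ l ∷ [])))
                                         (≤-reflexive (+-comm (k + l + 3) P)))
      (∣-∣+≤ Q (k + 1) P (k + l + 3) (≤-rearrange 0 q₂ (solve (P ∷ Q ∷ k ∷ l ∷ [])))
                                     (≤-rearrange 1 q₄ (solve (P ∷ Q ∷ k ∷ l ∷ [])))))

  A→B : CloserBulkNeighbour cornerA cornerB
  A→B = step-from-A ≤-refl z≤n

  A→C : CloserBulkNeighbour cornerA cornerC
  A→C = step-from-A {k + 2} {k + l + 3} (m+d≡n⇒m≤n (k + k + 3) (solve (k ∷ l ∷ [])))
                                      (m+d≡n⇒m≤n (l + l + 2) (solve (k ∷ l ∷ [])))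

  D→A : CloserBulkNeighbour cornerD cornerA
  D→A = step-from-D {l + 1} {0} (m+d≡n⇒m≤n (k + k + 3) (solve (k ∷ l ∷ [])))
                              (m+d≡n⇒m≤n 0 (solve (l ∷ [])))

  B→C : CloserBulkNeighbour cornerB cornerC
  B→C = step-from-B {k + 2} {k + l + 3} (m+d≡n⇒m≤n (k + k + 3) (solve (k ∷ l ∷ [])))
                                      (m+d≡n⇒m≤n 0 (solve (k ∷ l ∷ [])))

  B→D : CloserBulkNeighbour cornerB cornerD
  B→D = step-from-B {k + l + 3} {k + 1} (m+d≡n⇒m≤n (k + k + 2) (solve (k ∷ l ∷ [])))
                                      (m+d≡n⇒m≤n (l + l + 3) (solve (k ∷ l ∷ [])))

  C→D : CloserBulkNeighbour cornerC cornerD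
  C→D = step-from-C {k + l + 3} {k + 1} (m+d≡n⇒m≤n 0 (solve (k ∷ l ∷ [])))
                                      (m+d≡n⇒m≤n (l + l + 3) (solve (k ∷ l ∷ [])))

  data Site : ℕ² → Set where
    bulk : ∀ {p} → Bulk p → Site p
    at-A : Site cornerA
    at-B : Site cornerB
    at-C : Site cornerC
    at-D : Site cornerD

  site-step : ∀ {p q} → Site p → Site q → p ≡ q ⊎ CloserBulkNeighbour p q ⊎ CloserBulkNeighbour q p
  site-step {p} {q} (bulk bp) (bulk bq) with ≡-dec _≟_ _≟_ p q
  ... | yes p≡q = inj₁ p≡q
  ... | no p≢q = inj₂ (inj₁ (bulk-step bp bq p≢q))
  site-step at-A (bulk (q₁ , _ , _ , q₄)) = inj₂ (inj₁ (step-from-A q₁ q₄))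
  site-step at-B (bulk (q₁ , _ , q₃ , _)) = inj₂ (inj₁ (step-from-B q₁ q₃))
  site-step at-C (bulk (_ , q₂ , q₃ , _)) = inj₂ (inj₁ (step-from-C q₂ q₃))
  site-step at-D (bulk (_ , q₂ , _ , q₄)) = inj₂ (inj₁ (step-from-D q₂ q₄))
  site-step (bulk (p₁ , _ , _ , p₄)) at-A = inj₂ (inj₂ (step-from-A p₁ p₄))
  site-step (bulk (p₁ , _ , p₃ , _)) at-B = inj₂ (inj₂ (step-from-B p₁ p₃))
  site-step (bulk (_ , p₂ , p₃ , _)) at-C = inj₂ (inj₂ (step-from-C p₂ p₃))
  site-step (bulk (_ , p₂ , _ , p₄)) at-D = inj₂ (inj₂ (step-from-D p₂ p₄))
  site-step at-A at-A = inj₁ refl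
  site-step at-B at-B = inj₁ refl
  site-step at-C at-C = inj₁ refl
  site-step at-D at-D = inj₁ refl
  site-step at-A at-B = inj₂ (inj₁ A→B)
  site-step at-B at-A = inj₂ (inj₂ A→B)
  site-step at-A at-C = inj₂ (inj₁ A→C)
  site-step at-C at-A = inj₂ (inj₂ A→C)
  site-step at-A at-D = inj₂ (inj₂ D→A)
  site-step at-D at-A = inj₂ (inj₁ D→A)
  site-step at-B at-C = inj₂ (inj₁ B→C)
  site-step at-C at-B = inj₂ (inj₂ B→C)
  site-step at-B at-D = inj₂ (inj₁ B→D)
  site-step at-D at-B = inj₂ (inj₂ B→D)
  site-step at-C at-D = inj₂ (inj₁ C→D)
  site-step at-D at-C = inj₂ (inj₂ C→D)

+-−-≤⇔ : ∀ a b c d → (+ a ℤ.- + b ℤ.≤ + c ℤ.- + d) ⇔ (a + d ≤ c + b)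
+-−-≤⇔ a b c d = mk⇔ to from
  where
  to : + a ℤ.- + b ℤ.≤ + c ℤ.- + d → a + d ≤ c + b
  to h = ℤ.drop‿+≤+ (subst₂ ℤ._≤_ (trans (shift (+ a) (+ b) (+ d)) (sym (ℤ.pos-+ a d)))
                                  (trans (shift′ (+ c) (+ d) (+ b)) (sym (ℤ.pos-+ c b)))
                                  (ℤ.+-monoˡ-≤ (+ b ℤ.+ + d) h))
    where
    shift : ∀ i j k → (i ℤ.- j) ℤ.+ (j ℤ.+ k) ≡ i ℤ.+ k
    shift = ℤ-Solver.solve-∀
    shift′ : ∀ i j k → (i ℤ.- j) ℤ.+ (k ℤ.+ j) ≡ i ℤ.+ k
    shift′ = ℤ-Solver.solve-∀
  from : a + d ≤ c + b → + a ℤ.- + b ℤ.≤ + c ℤ.- + d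
  from h = subst₂ ℤ._≤_ (unshift (+ a) (+ d) (+ b)) (unshift′ (+ c) (+ b) (+ d))
             (ℤ.+-monoˡ-≤ (ℤ.- (+ b ℤ.+ + d)) (subst₂ ℤ._≤_ (ℤ.pos-+ a d) (ℤ.pos-+ c b) (ℤ.+≤+ h)))
    where
    unshift : ∀ i j k → (i ℤ.+ j) ℤ.+ ℤ.- (k ℤ.+ j) ≡ i ℤ.- k
    unshift = ℤ-Solver.solve-∀
    unshift′ : ∀ i j k → (i ℤ.+ j) ℤ.+ ℤ.- (j ℤ.+ k) ≡ i ℤ.- k
    unshift′ = ℤ-Solver.solve-∀

∣m⊖n∣≡∣m-n∣ : ∀ m n → ∣ m ℤ.⊖ n ∣ ≡ ∣ m - n ∣
∣m⊖n∣≡∣m-n∣ zero zero = refl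
∣m⊖n∣≡∣m-n∣ zero (suc n) = refl
∣m⊖n∣≡∣m-n∣ (suc m) zero = refl
∣m⊖n∣≡∣m-n∣ (suc m) (suc n) = trans (cong ∣_∣ (ℤ.[1+m]⊖[1+n]≡m⊖n m n)) (∣m⊖n∣≡∣m-n∣ m n)

-1≤i+i⇒0≤i : ∀ {i} → -[1+ 0 ] ℤ.≤ i ℤ.+ i → + 0 ℤ.≤ i
-1≤i+i⇒0≤i {+ n} _ = ℤ.+≤+ z≤n
-1≤i+i⇒0≤i { -[1+ n ]} (ℤ.-≤- ())

module Coordinates (k l : ℕ) where
  open Region k l

  toPoint : ℕ² → Point
  toPoint (X , Y) = (+ X ℤ.- + 1 , + Y ℤ.- + suc l)

  fromPoint : Point → ℕ²
  fromPoint (x , y) = (∣ x ℤ.+ + 1 ∣ , ∣ y ℤ.+ + suc l ∣)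

  fromPoint-toPoint : ∀ p → fromPoint (toPoint p) ≡ p
  fromPoint-toPoint (X , Y) = cong₂ _,_ (cong ∣_∣ (cancel (+ X) (+ 1))) (cong ∣_∣ (cancel (+ Y) (+ suc l)))
    where
    cancel : ∀ i j → (i ℤ.- j) ℤ.+ j ≡ i
    cancel = ℤ-Solver.solve-∀

  toPoint-fromPoint : ∀ {x y} → + 0 ℤ.≤ x ℤ.+ + 1 → + 0 ℤ.≤ y ℤ.+ + suc l → toPoint (fromPoint (x , y)) ≡ (x , y)
  toPoint-fromPoint {x} {y} 0≤x+1 0≤y+l+1 =
    cong₂ _,_ (trans (cong (ℤ._- + 1) (ℤ.0≤i⇒+∣i∣≡i 0≤x+1)) (uncancel x (+ 1)))
              (trans (cong (ℤ._- + suc l) (ℤ.0≤i⇒+∣i∣≡i 0≤y+l+1)) (uncancel y (+ suc l)))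
    where
    uncancel : ∀ i j → (i ℤ.+ j) ℤ.- j ≡ i
    uncancel = ℤ-Solver.solve-∀

  toPoint-injective : ∀ {p q} → toPoint p ≡ toPoint q → p ≡ q
  toPoint-injective {p} {q} e = trans (sym (fromPoint-toPoint p)) (trans (cong fromPoint e) (fromPoint-toPoint q))

  chebyshev-toPoint : ∀ p q → chebyshev (toPoint p) (toPoint q) ≡ chebyshevℕ p q
  chebyshev-toPoint (X , Y) (X′ , Y′) = cong₂ _⊔_ (∣shift∣ X X′ (+ 1)) (∣shift∣ Y Y′ (+ suc l))
    where
    ∣shift∣ : ∀ m n i → ∣ (+ m ℤ.- i) ℤ.- (+ n ℤ.- i) ∣ ≡ ∣ m - n ∣
    ∣shift∣ m n i = trans (cong ∣_∣ (trans (cancel (+ m) (+ n) i) (ℤ.[+m]-[+n]≡m⊖n m n))) (∣m⊖n∣≡∣m-n∣ m n)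
      where
      cancel : ∀ a b c → (a ℤ.- c) ℤ.- (b ℤ.- c) ≡ a ℤ.- b
      cancel = ℤ-Solver.solve-∀

  s-toPoint : ∀ X Y → s (toPoint (X , Y)) ≡ + (X + Y) ℤ.- + (l + 2)
  s-toPoint X Y = trans (cong (λ z → (+ X ℤ.- + 1) ℤ.+ (+ Y ℤ.- z)) (ℤ.pos-+ 1 l))
                 (trans (regroup (+ X) (+ Y) (+ l))
                        (sym (cong₂ ℤ._-_ (ℤ.pos-+ X Y) (ℤ.pos-+ l 2))))
    where
    regroup : ∀ x y z → (x ℤ.- + 1) ℤ.+ (y ℤ.- (+ 1 ℤ.+ z)) ≡ (x ℤ.+ y) ℤ.- (z ℤ.+ + 2)
    regroup = ℤ-Solver.solve-∀

  t-toPoint : ∀ X Y → t (toPoint (X , Y)) ≡ + (X + l) ℤ.- + Y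
  t-toPoint X Y = trans (cong (λ z → (+ X ℤ.- + 1) ℤ.- (+ Y ℤ.- z)) (ℤ.pos-+ 1 l))
                 (trans (regroup (+ X) (+ Y) (+ l)) (sym (cong (ℤ._- + Y) (ℤ.pos-+ X l))))
    where
    regroup : ∀ x y z → (x ℤ.- + 1) ℤ.- (y ℤ.- (+ 1 ℤ.+ z)) ≡ (x ℤ.+ z) ℤ.- y
    regroup = ℤ-Solver.solve-∀

  InRectangle : Point → Set
  InRectangle u = (+ 0 ℤ.≤ s u × s u ℤ.≤ + (2 * k + 2)) × (-[1+ 0 ] ℤ.≤ t u × t u ℤ.≤ + (2 * l + 1))

  Bulk⇔InRectangle : ∀ X Y → Bulk (X , Y) ⇔ InRectangle (toPoint (X , Y))
  Bulk⇔InRectangle X Y = mk⇔ encode decode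
    where
    open Equivalence using () renaming (to to ⇒; from to ⇐)

    +n-0≡+n : ∀ n → + n ℤ.- + 0 ≡ + n
    +n-0≡+n n = ℤ.+-identityʳ (+ n)

    encode : Bulk (X , Y) → InRectangle (toPoint (X , Y))
    encode (q₁ , q₂ , q₃ , q₄) =
      (subst (+ 0 ℤ.≤_) (sym (s-toPoint X Y))
         (⇐ (+-−-≤⇔ 0 0 (X + Y) (l + 2)) (≤-rearrange 0 q₁ (solve (X ∷ Y ∷ l ∷ [])))) ,
       subst₂ ℤ._≤_ (sym (s-toPoint X Y)) (+n-0≡+n (2 * k + 2))
         (⇐ (+-−-≤⇔ (X + Y) (l + 2) (2 * k + 2) 0) (≤-rearrange 0 q₂ (solve (X ∷ Y ∷ k ∷ l ∷ []))))) ,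
      (subst (-[1+ 0 ] ℤ.≤_) (sym (t-toPoint X Y))
         (⇐ (+-−-≤⇔ 0 1 (X + l) Y) (≤-rearrange 0 q₃ (solve (X ∷ Y ∷ l ∷ [])))) ,
       subst₂ ℤ._≤_ (sym (t-toPoint X Y)) (+n-0≡+n (2 * l + 1))
         (⇐ (+-−-≤⇔ (X + l) Y (2 * l + 1) 0) (≤-rearrange 0 q₄ (solve (X ∷ Y ∷ l ∷ [])))))

    decode : InRectangle (toPoint (X , Y)) → Bulk (X , Y)
    decode ((c₁ , c₂) , (c₃ , c₄)) =
      ≤-rearrange 0 (⇒ (+-−-≤⇔ 0 0 (X + Y) (l + 2)) (subst (+ 0 ℤ.≤_) (s-toPoint X Y) c₁))
        (solve (X ∷ Y ∷ l ∷ [])) ,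
      ≤-rearrange 0 (⇒ (+-−-≤⇔ (X + Y) (l + 2) (2 * k + 2) 0)
                       (subst₂ ℤ._≤_ (s-toPoint X Y) (sym (+n-0≡+n (2 * k + 2))) c₂))
        (solve (X ∷ Y ∷ k ∷ l ∷ [])) ,
      ≤-rearrange 0 (⇒ (+-−-≤⇔ 0 1 (X + l) Y) (subst (-[1+ 0 ] ℤ.≤_) (t-toPoint X Y) c₃))
        (solve (X ∷ Y ∷ l ∷ [])) ,
      ≤-rearrange 0 (⇒ (+-−-≤⇔ (X + l) Y (2 * l + 1) 0)
                       (subst₂ ℤ._≤_ (t-toPoint X Y) (sym (+n-0≡+n (2 * l + 1))) c₄))
        (solve (X ∷ Y ∷ l ∷ []))

  toPoint-A : toPoint cornerA ≡ aH k l
  toPoint-A = cong₂ _,_ (trans (cong (ℤ._- + 1) (ℤ.pos-+ l 1)) (cancel (+ l) (+ 1)))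
                        (trans (ℤ.+-identityˡ _) (cong (λ n → ℤ.- + n) (+-comm 1 l)))
    where
    cancel : ∀ i j → (i ℤ.+ j) ℤ.- j ≡ i
    cancel = ℤ-Solver.solve-∀

  toPoint-B : toPoint cornerB ≡ bH k l
  toPoint-B = cong (-[1+ 0 ] ,_) (trans (cong₂ ℤ._-_ (ℤ.pos-+ l 2) (ℤ.pos-+ 1 l)) (cancel (+ l)))
    where
    cancel : ∀ i → (i ℤ.+ + 2) ℤ.- (+ 1 ℤ.+ i) ≡ + 1
    cancel = ℤ-Solver.solve-∀

  toPoint-C : toPoint cornerC ≡ cH k l
  toPoint-C = cong₂ _,_ (trans (cong (ℤ._- + 1) (ℤ.pos-+ k 2)) (trans (cancel₁ (+ k)) (sym (ℤ.pos-+ k 1))))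
                        (trans (cong₂ ℤ._-_ (trans (ℤ.pos-+ (k + l) 3) (cong (ℤ._+ + 3) (ℤ.pos-+ k l))) (ℤ.pos-+ 1 l))
                               (trans (cancel₂ (+ k) (+ l)) (sym (ℤ.pos-+ k 2))))
    where
    cancel₁ : ∀ i → (i ℤ.+ + 2) ℤ.- + 1 ≡ i ℤ.+ + 1
    cancel₁ = ℤ-Solver.solve-∀
    cancel₂ : ∀ i j → (i ℤ.+ j ℤ.+ + 3) ℤ.- (+ 1 ℤ.+ j) ≡ i ℤ.+ + 2
    cancel₂ = ℤ-Solver.solve-∀

  toPoint-D : toPoint cornerD ≡ dH k l
  toPoint-D = cong₂ _,_ (trans (cong (ℤ._- + 1) (trans (ℤ.pos-+ (k + l) 3) (cong (ℤ._+ + 3) (ℤ.pos-+ k l))))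
                               (trans (cancel₁ (+ k) (+ l)) (sym (trans (ℤ.pos-+ (k + l) 2) (cong (ℤ._+ + 2) (ℤ.pos-+ k l))))))
                        (trans (cong₂ ℤ._-_ (ℤ.pos-+ k 1) (ℤ.pos-+ 1 l)) (cancel₂ (+ k) (+ l)))
    where
    cancel₁ : ∀ i j → (i ℤ.+ j ℤ.+ + 3) ℤ.- + 1 ≡ i ℤ.+ j ℤ.+ + 2
    cancel₁ = ℤ-Solver.solve-∀
    cancel₂ : ∀ i j → (i ℤ.+ + 1) ℤ.- (+ 1 ℤ.+ j) ≡ i ℤ.- j
    cancel₂ = ℤ-Solver.solve-∀

  Site⇒InH : ∀ {p} → Site p → InH k l (toPoint p)
  Site⇒InH {X , Y} (bulk b) = inj₁ (Equivalence.to (Bulk⇔InRectangle X Y) b)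
  Site⇒InH at-A = inj₂ (inj₁ toPoint-A)
  Site⇒InH at-B = inj₂ (inj₂ (inj₁ toPoint-B))
  Site⇒InH at-C = inj₂ (inj₂ (inj₂ (inj₁ toPoint-C)))
  Site⇒InH at-D = inj₂ (inj₂ (inj₂ (inj₂ toPoint-D)))

  InRectangle⇒toPoint-fromPoint : ∀ {u} → InRectangle u → toPoint (fromPoint u) ≡ u
  InRectangle⇒toPoint-fromPoint {x , y} ((c₁ , _) , (c₃ , c₄)) =
    toPoint-fromPoint (ℤ.+-mono-≤ 0≤x (ℤ.+≤+ z≤n)) (subst (+ 0 ℤ.≤_) (regroup y (+ l)) (ℤ.+-mono-≤ 0≤y+l (ℤ.+≤+ z≤n)))
    where
    0≤x : + 0 ℤ.≤ x
    0≤x = -1≤i+i⇒0≤i (subst (-[1+ 0 ] ℤ.≤_) (double x y) (ℤ.+-mono-≤ c₁ c₃))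
      where
      double : ∀ i j → (i ℤ.+ j) ℤ.+ (i ℤ.- j) ≡ i ℤ.+ i
      double = ℤ-Solver.solve-∀
    2l+1≡ : + (2 * l + 1) ≡ + l ℤ.+ + l ℤ.+ + 1
    2l+1≡ = trans (cong +_ ℕ-form) (trans (ℤ.pos-+ (l + l) 1) (cong (ℤ._+ + 1) (ℤ.pos-+ l l)))
      where
      ℕ-form : 2 * l + 1 ≡ l + l + 1
      ℕ-form = solve (l ∷ [])
    0≤y+l : + 0 ℤ.≤ y ℤ.+ + l
    0≤y+l = -1≤i+i⇒0≤i (subst (-[1+ 0 ] ℤ.≤_) (double x y (+ l))
              (ℤ.+-mono-≤ (ℤ.+-mono-≤ c₁ (subst (λ z → + 0 ℤ.≤ z ℤ.- (x ℤ.- y)) 2l+1≡ (ℤ.i≤j⇒0≤j-i c₄))) (ℤ.≤-refl { -[1+ 0 ]})))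
      where
      double : ∀ i j m → ((i ℤ.+ j) ℤ.+ ((m ℤ.+ m ℤ.+ + 1) ℤ.- (i ℤ.- j))) ℤ.+ ℤ.- + 1 ≡ (j ℤ.+ m) ℤ.+ (j ℤ.+ m)
      double = ℤ-Solver.solve-∀
    regroup : ∀ i j → (i ℤ.+ j) ℤ.+ + 1 ≡ i ℤ.+ (+ 1 ℤ.+ j)
    regroup = ℤ-Solver.solve-∀

  at-corner : ∀ {p u} → Site p → toPoint p ≡ u → Site (fromPoint u) × toPoint (fromPoint u) ≡ u
  at-corner {p} site refl = subst Site (sym (fromPoint-toPoint p)) site , cong toPoint (fromPoint-toPoint p)

  InH⇒Site : ∀ {u} → InH k l u → Site (fromPoint u) × toPoint (fromPoint u) ≡ u
  InH⇒Site {u} (inj₁ rect) = bulk (Equivalence.from (Bulk⇔InRectangle _ _) (subst InRectangle (sym u≡) rect)) , u≡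
    where
    u≡ : toPoint (fromPoint u) ≡ u
    u≡ = InRectangle⇒toPoint-fromPoint rect
  InH⇒Site (inj₂ (inj₁ refl)) = at-corner at-A toPoint-A
  InH⇒Site (inj₂ (inj₂ (inj₁ refl))) = at-corner at-B toPoint-B
  InH⇒Site (inj₂ (inj₂ (inj₂ (inj₁ refl)))) = at-corner at-C toPoint-C
  InH⇒Site (inj₂ (inj₂ (inj₂ (inj₂ refl)))) = at-corner at-D toPoint-D

module H-Geodesics (k l : ℕ) where
  open Region k l
  open Coordinates k l

  EH-sym : ∀ {u v} → EH k l u v → EH k l v u
  EH-sym (u∈ , v∈ , uv) = v∈ , u∈ , King-sym uv

  lift-step : ∀ {p q} → Site p → CloserBulkNeighbour p q →
              CloserNeighbour (EH k l) chebyshev (InH k l) (toPoint p) (toPoint q)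
  lift-step {p} {q} p-site (r , r-bulk , (p≢r , pr≤1) , closer) =
    toPoint r , Site⇒InH (bulk r-bulk) ,
    (Site⇒InH p-site , Site⇒InH (bulk r-bulk) ,
     chebyshev≤1⇒King (p≢r ∘ toPoint-injective) (subst (_≤ 1) (sym (chebyshev-toPoint p r)) pr≤1)) ,
    subst₂ (λ x y → suc x ≤ y) (sym (chebyshev-toPoint r q)) (sym (chebyshev-toPoint p q)) closer

  Descent : Point → Point → Set
  Descent u v = u ≡ v ⊎ CloserNeighbour (EH k l) chebyshev (InH k l) u v ⊎ CloserNeighbour (EH k l) chebyshev (InH k l) v u

  site-descent : ∀ {p q} → Site p → Site q → Descent (toPoint p) (toPoint q)
  site-descent p-site q-site with site-step p-site q-site
  ... | inj₁ p≡q = inj₁ (cong toPoint p≡q)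
  ... | inj₂ (inj₁ step) = inj₂ (inj₁ (lift-step p-site step))
  ... | inj₂ (inj₂ step) = inj₂ (inj₂ (lift-step q-site step))

  H-geodesic : ∀ {u v} → InH k l u → InH k l v → ∃ λ m → Walk (EH k l) u v m × m ≤ chebyshev u v
  H-geodesic = geodesic-by-descent (EH k l) chebyshev (InH k l) EH-sym chebyshev-sym descend
    where
    descend : ∀ {u v} → InH k l u → InH k l v → Descent u v
    descend u∈ v∈ with InH⇒Site u∈ | InH⇒Site v∈
    ... | u-site , u≡ | v-site , v≡ = subst₂ Descent u≡ v≡ (site-descent u-site v-site)

-- The embedding

module _ (G : Graph) (k l : ℕ) {a b c d : V G} where
  open Graph G
  open H-Geodesics k l
  open Walk using ([]; _∷_)

  H-dist : ∀ {u v} → InH k l u → InH k l v → Dist (EH k l) u v (chebyshev u v)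
  H-dist u∈ v∈ = dist-from-bounds (H-geodesic u∈ v∈) (chebyshev≤length (proj₂ ∘ proj₂))

  isometricH3 : (f : Point → V G) → (∀ {u v} → InH k l u → InH k l v → Dist _~_ (f u) (f v) (chebyshev u v)) →
                f (aH k l) ≡ a → f (bH k l) ≡ b → f (cH k l) ≡ c → f (dH k l) ≡ d → IsometricH3 G k l a b c d
  isometricH3 f G-dist f-a f-b f-c f-d = record
    { f = f
    ; f-inj = λ p q p∈ q∈ fp≡fq → chebyshev≤0⇒≡ p q (proj₂ (G-dist p∈ q∈) (subst (λ z → Walk _~_ (f p) z 0) fp≡fq []))
    ; f-adj = λ p q p∈ q∈ pq → walk-1⇒edge (subst (Walk _~_ (f p) (f q)) (adjacent-distance pq) (proj₁ (G-dist p∈ q∈)))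
    ; f-adj⁻ = λ p q p∈ q∈ e → chebyshev≤1⇒King (λ { refl → ~-irrefl e }) (proj₂ (G-dist p∈ q∈) (e ∷ []))
    ; f-dist = λ p q m p∈ q∈ dH → subst (Dist _~_ (f p) (f q)) (Dist-unique (H-dist p∈ q∈) dH) (G-dist p∈ q∈)
    ; f-dist⁻ = λ p q m p∈ q∈ dG → subst (Dist (EH k l) p q) (Dist-unique (G-dist p∈ q∈) dG) (H-dist p∈ q∈)
    ; f-a = f-a ; f-b = f-b ; f-c = f-c ; f-d = f-d
    }
    where
    adjacent-distance : ∀ {p q} → King p q → chebyshev p q ≡ 1
    adjacent-distance {p} {q} pq = ≤-antisym (King⇒chebyshev≤1 pq) (≰⇒> (proj₁ pq ∘ chebyshev≤0⇒≡ p q))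

module Construction (k l : ℕ) (G : Graph) (helly : Helly G) (a b c d : V G) (frame : Frame3 G k l a b c d) where
  open Graph G
  open Frame3 frame
  open Region k l
  open Coordinates k l
  open HellyExtension G helly (≡-dec _≟_ _≟_) chebyshevℕ chebyshevℕ-sym chebyshevℕ-refl chebyshevℕ-triangle
  open Walk using ([]; _∷_)

  frame-within : ∀ {x y n r} → Dist _~_ x y n → r ≡ n → WalkWithin x y r
  frame-within (w , _) refl = _ , w , ≤-refl

  corners : List Assignment
  corners = (cornerA , a) ∷ (cornerB , b) ∷ (cornerC , c) ∷ (cornerD , d) ∷ []

  pattern A∈ = here refl
  pattern B∈ = there (here refl)
  pattern C∈ = there (there (here refl))
  pattern D∈ = there (there (there (here refl)))

  corners-compatible : Compatible corners
  corners-compatible A∈ A∈ = 0 , [] , z≤n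
  corners-compatible B∈ B∈ = 0 , [] , z≤n
  corners-compatible C∈ C∈ = 0 , [] , z≤n
  corners-compatible D∈ D∈ = 0 , [] , z≤n
  corners-compatible A∈ B∈ = frame-within dG-ab chebyshevℕ-AB
  corners-compatible B∈ A∈ = reverse-within (chebyshevℕ-sym cornerA cornerB) (frame-within dG-ab chebyshevℕ-AB)
  corners-compatible A∈ C∈ = frame-within dG-ac chebyshevℕ-AC
  corners-compatible C∈ A∈ = reverse-within (chebyshevℕ-sym cornerA cornerC) (frame-within dG-ac chebyshevℕ-AC)
  corners-compatible D∈ A∈ = frame-within dG-da (trans (chebyshevℕ-sym cornerD cornerA) chebyshevℕ-AD)
  corners-compatible A∈ D∈ = reverse-within (chebyshevℕ-sym cornerD cornerA)
                                            (frame-within dG-da (trans (chebyshevℕ-sym cornerD cornerA) chebyshevℕ-AD))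
  corners-compatible B∈ C∈ = frame-within dG-bc chebyshevℕ-BC
  corners-compatible C∈ B∈ = reverse-within (chebyshevℕ-sym cornerB cornerC) (frame-within dG-bc chebyshevℕ-BC)
  corners-compatible B∈ D∈ = frame-within dG-bd chebyshevℕ-BD
  corners-compatible D∈ B∈ = reverse-within (chebyshevℕ-sym cornerB cornerD) (frame-within dG-bd chebyshevℕ-BD)
  corners-compatible C∈ D∈ = frame-within dG-cd chebyshevℕ-CD
  corners-compatible D∈ C∈ = reverse-within (chebyshevℕ-sym cornerC cornerD) (frame-within dG-cd chebyshevℕ-CD)
  corners-compatible (there (there (there (there ())))) _
  corners-compatible _ (there (there (there (there ()))))

  grid : List ℕ²
  grid = cartesianProduct (upTo (suc (k + l + 2))) (upTo (suc (k + l + 2)))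

  bulk∈grid : ∀ {p} → Bulk p → p ∈ grid
  bulk∈grid p-bulk with bulk-bounded p-bulk
  ... | X≤ , Y≤ = ∈-cartesianProduct⁺ (∈-upTo⁺ (s≤s X≤)) (∈-upTo⁺ (s≤s Y≤))

  seeded : Σ PartialMap λ φ → All (λ (p , x) → p ↦ x ∈ φ) corners × (∀ {p x} → p ↦ x ∈ φ → (p , x) ∈ corners)
  seeded = seed cornerA a ((cornerB , b) ∷ (cornerC , c) ∷ (cornerD , d) ∷ []) corners-compatible

  -- Opaque: unfolding the extension over the whole grid makes type checking intractable.
  opaque
    extended : Σ PartialMap λ φ → proj₁ seeded ⊑ φ × All (dom φ) grid
    extended = extend-all (proj₁ seeded) grid

  φ : PartialMap
  φ = proj₁ extended

  F : ℕ² → V G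
  F = map φ

  corner-values : All (λ (p , x) → p ↦ x ∈ φ) corners
  corner-values = All.map (proj₁ (proj₂ extended)) (proj₁ (proj₂ seeded))

  A↦a : cornerA ↦ a ∈ φ
  A↦a = All.lookup corner-values A∈

  B↦b : cornerB ↦ b ∈ φ
  B↦b = All.lookup corner-values B∈

  C↦c : cornerC ↦ c ∈ φ
  C↦c = All.lookup corner-values C∈

  D↦d : cornerD ↦ d ∈ φ
  D↦d = All.lookup corner-values D∈

  site∈dom : ∀ {p} → Site p → dom φ p
  site∈dom (bulk p-bulk) = All.lookup (proj₂ (proj₂ extended)) (bulk∈grid p-bulk)
  site∈dom at-A = proj₁ A↦a
  site∈dom at-B = proj₁ B↦b
  site∈dom at-C = proj₁ C↦c
  site∈dom at-D = proj₁ D↦d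

  Y-gap≤length : ∀ {p q hp hq m} → dom φ p → dom φ q → chebyshevℕ cornerA p ≤ hp → chebyshevℕ q cornerC + hq ≤ k + l + 3 →
           Walk _~_ (F p) (F q) m → hq ≤ hp + m
  Y-gap≤length = height-gap≤length φ A↦a C↦c (proj₂ dG-ac)

  X-gap≤length : ∀ {p q hp hq m} → dom φ p → dom φ q → chebyshevℕ cornerB p ≤ hp → chebyshevℕ q cornerD + hq ≤ k + l + 3 →
           Walk _~_ (F p) (F q) m → hq ≤ hp + m
  X-gap≤length = height-gap≤length φ B↦b D↦d (proj₂ dG-bd)

  bulk-lower : ∀ {p q m} → Bulk p → Bulk q → Walk _~_ (F p) (F q) m → chebyshevℕ p q ≤ m
  bulk-lower {p} {q} {m} p-bulk q-bulk w = ⊔-lub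
    (∣-∣≤ (X-gap≤length q∈ p∈ (chebyshevℕ-B≤X q-bulk) (chebyshevℕ-D+X≤ p-bulk) w⁻¹)
          (X-gap≤length p∈ q∈ (chebyshevℕ-B≤X p-bulk) (chebyshevℕ-D+X≤ q-bulk) w))
    (∣-∣≤ (Y-gap≤length q∈ p∈ (chebyshevℕ-A≤Y q-bulk) (chebyshevℕ-C+Y≤ p-bulk) w⁻¹)
          (Y-gap≤length p∈ q∈ (chebyshevℕ-A≤Y p-bulk) (chebyshevℕ-C+Y≤ q-bulk) w))
    where
    p∈ : dom φ p
    p∈ = site∈dom (bulk p-bulk)
    q∈ : dom φ q
    q∈ = site∈dom (bulk q-bulk)
    w⁻¹ : Walk _~_ (F q) (F p) m
    w⁻¹ = reverseʷ ~-sym w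

  A-lower : ∀ {q m} → Bulk q → Walk _~_ (F cornerA) (F q) m → chebyshevℕ cornerA q ≤ m
  A-lower q-bulk w = ≤-trans (chebyshevℕ-A≤Y q-bulk)
    (Y-gap≤length (proj₁ A↦a) (site∈dom (bulk q-bulk)) (≤-reflexive (chebyshevℕ-refl cornerA)) (chebyshevℕ-C+Y≤ q-bulk) w)

  B-lower : ∀ {q m} → Bulk q → Walk _~_ (F cornerB) (F q) m → chebyshevℕ cornerB q ≤ m
  B-lower q-bulk w = ≤-trans (chebyshevℕ-B≤X q-bulk)
    (X-gap≤length (proj₁ B↦b) (site∈dom (bulk q-bulk)) (≤-reflexive (chebyshevℕ-refl cornerB)) (chebyshevℕ-D+X≤ q-bulk) w)

  C-lower : ∀ {q m} → Bulk q → Walk _~_ (F cornerC) (F q) m → chebyshevℕ cornerC q ≤ m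
  C-lower {q@(_ , Y)} {m} q-bulk w = subst (_≤ m) (chebyshevℕ-sym q cornerC) (+-cancelˡ-≤ Y _ m (begin
    Y + chebyshevℕ q cornerC ≡⟨ +-comm Y _ ⟩
    chebyshevℕ q cornerC + Y ≤⟨ chebyshevℕ-C+Y≤ q-bulk ⟩
    k + l + 3               ≤⟨ Y-gap≤length (site∈dom (bulk q-bulk)) (proj₁ C↦c) (chebyshevℕ-A≤Y q-bulk)
                                      (≤-reflexive (cong (_+ (k + l + 3)) (chebyshevℕ-refl cornerC))) (reverseʷ ~-sym w) ⟩
    Y + m                   ∎))
    where open ≤-Reasoning

  D-lower : ∀ {q m} → Bulk q → Walk _~_ (F cornerD) (F q) m → chebyshevℕ cornerD q ≤ m
  D-lower {q@(X , _)} {m} q-bulk w = subst (_≤ m) (chebyshevℕ-sym q cornerD) (+-cancelˡ-≤ X _ m (begin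
    X + chebyshevℕ q cornerD ≡⟨ +-comm X _ ⟩
    chebyshevℕ q cornerD + X ≤⟨ chebyshevℕ-D+X≤ q-bulk ⟩
    k + l + 3               ≤⟨ X-gap≤length (site∈dom (bulk q-bulk)) (proj₁ D↦d) (chebyshevℕ-B≤X q-bulk)
                                      (≤-reflexive (cong (_+ (k + l + 3)) (chebyshevℕ-refl cornerD))) (reverseʷ ~-sym w) ⟩
    X + m                   ∎))
    where open ≤-Reasoning

  corner-lower : ∀ {p q x y n m} → p ↦ x ∈ φ → q ↦ y ∈ φ → Dist _~_ x y n → chebyshevℕ p q ≡ n →
                 Walk _~_ (F p) (F q) m → chebyshevℕ p q ≤ m
  corner-lower (_ , refl) (_ , refl) (_ , shortest) refl w = shortest w

  flip-lower : ∀ {p q} → (∀ {m} → Walk _~_ (F p) (F q) m → chebyshevℕ p q ≤ m) →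
               ∀ {m} → Walk _~_ (F q) (F p) m → chebyshevℕ q p ≤ m
  flip-lower {p} {q} lower {m} w = subst (_≤ m) (chebyshevℕ-sym p q) (lower (reverseʷ ~-sym w))

  site-lower : ∀ {p q m} → Site p → Site q → Walk _~_ (F p) (F q) m → chebyshevℕ p q ≤ m
  site-lower (bulk p-bulk) (bulk q-bulk) = bulk-lower p-bulk q-bulk
  site-lower at-A (bulk q-bulk) = A-lower q-bulk
  site-lower at-B (bulk q-bulk) = B-lower q-bulk
  site-lower at-C (bulk q-bulk) = C-lower q-bulk
  site-lower at-D (bulk q-bulk) = D-lower q-bulk
  site-lower (bulk p-bulk) at-A = flip-lower (A-lower p-bulk)
  site-lower (bulk p-bulk) at-B = flip-lower (B-lower p-bulk)
  site-lower (bulk p-bulk) at-C = flip-lower (C-lower p-bulk)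
  site-lower (bulk p-bulk) at-D = flip-lower (D-lower p-bulk)
  site-lower at-A at-A _ = ≤-trans (≤-reflexive (chebyshevℕ-refl cornerA)) z≤n
  site-lower at-B at-B _ = ≤-trans (≤-reflexive (chebyshevℕ-refl cornerB)) z≤n
  site-lower at-C at-C _ = ≤-trans (≤-reflexive (chebyshevℕ-refl cornerC)) z≤n
  site-lower at-D at-D _ = ≤-trans (≤-reflexive (chebyshevℕ-refl cornerD)) z≤n
  site-lower at-A at-B = corner-lower A↦a B↦b dG-ab chebyshevℕ-AB
  site-lower at-B at-A = flip-lower (corner-lower A↦a B↦b dG-ab chebyshevℕ-AB)
  site-lower at-A at-C = corner-lower A↦a C↦c dG-ac chebyshevℕ-AC
  site-lower at-C at-A = flip-lower (corner-lower A↦a C↦c dG-ac chebyshevℕ-AC)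
  site-lower at-D at-A = corner-lower D↦d A↦a dG-da (trans (chebyshevℕ-sym cornerD cornerA) chebyshevℕ-AD)
  site-lower at-A at-D = flip-lower (corner-lower D↦d A↦a dG-da (trans (chebyshevℕ-sym cornerD cornerA) chebyshevℕ-AD))
  site-lower at-B at-C = corner-lower B↦b C↦c dG-bc chebyshevℕ-BC
  site-lower at-C at-B = flip-lower (corner-lower B↦b C↦c dG-bc chebyshevℕ-BC)
  site-lower at-B at-D = corner-lower B↦b D↦d dG-bd chebyshevℕ-BD
  site-lower at-D at-B = flip-lower (corner-lower B↦b D↦d dG-bd chebyshevℕ-BD)
  site-lower at-C at-D = corner-lower C↦c D↦d dG-cd chebyshevℕ-CD
  site-lower at-D at-C = flip-lower (corner-lower C↦c D↦d dG-cd chebyshevℕ-CD)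

  site-dist : ∀ {p q} → Site p → Site q → Dist _~_ (F p) (F q) (chebyshevℕ p q)
  site-dist p-site q-site =
    dist-from-bounds (nonexpansive φ (site∈dom p-site) (site∈dom q-site)) (site-lower p-site q-site)

  f : Point → V G
  f = F ∘ fromPoint

  G-dist : ∀ {u v} → InH k l u → InH k l v → Dist _~_ (f u) (f v) (chebyshev u v)
  G-dist {u} {v} u∈ v∈ with InH⇒Site u∈ | InH⇒Site v∈
  ... | u-site , u≡ | v-site , v≡ = subst (Dist _~_ (f u) (f v))
    (trans (sym (chebyshev-toPoint (fromPoint u) (fromPoint v))) (cong₂ chebyshev u≡ v≡)) (site-dist u-site v-site)

  f-corner : ∀ {p u x} → toPoint p ≡ u → p ↦ x ∈ φ → f u ≡ x
  f-corner {p} refl (_ , Fp≡x) = trans (cong F (fromPoint-toPoint p)) Fp≡x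

lemma7 : (k l : ℕ) (G : Graph) → Helly G →
    (a b c d : V G) → Frame3 G k l a b c d →
    IsometricH3 G k l a b c d
lemma7 k l G helly a b c d frame =
  isometricH3 G k l f G-dist (f-corner toPoint-A A↦a) (f-corner toPoint-B B↦b)
                             (f-corner toPoint-C C↦c) (f-corner toPoint-D D↦d)
  where
  open Construction k l G helly a b c d frame
  open Coordinates k l
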